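{- Let $k\ge 3$, fix $\delta \in (0,1)$ and let $p = p(n)=\omega(1/n^{k-1})$. Then with high probability $\mathcal{H}\sim\mathcal{H}_k(n,p)$ does not contain a subset $W$ of vertices with $|W| \le \delta n$ such that both of the following hold: (i) no hyperedge of $\mathcal{H}$ intersects $W$ in exactly one vertex, and (ii) at least $|W|$ hyperedges of $\mathcal{H}$ intersect $W$.
   Context: $\mathcal{H}_k(n,p)$ is the random $k$-uniform hypergraph on vertex set $[n]$ in which each $k$-subset of $[n]$ is a hyperedge independently with probability $p$. "With high probability" means with probability tending to $1$ as $n\to\infty$.
   Formalization: The parameter δ and the edge probabilities $p = p(n)$ take rational values rather than real ones. -}

module Defs where

open import Data.Bool using (Bool; true; false)
open import Data.Nat as ℕ using (ℕ; zero; suc)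
open import Data.Integer using (+_)
open import Data.Rational using (ℚ; _/_; _+_; _*_; _-_; 0ℚ; 1ℚ; _≤_)
open import Data.Fin.Subset using (Subset; ∣_∣; _∩_; Nonempty)
open import Data.Vec using ([]; _∷_)
open import Data.List using (List; []; _∷_; _++_; map; filter; length; concatMap)
open import Data.List.Relation.Unary.All using (All)
open import Data.List.Relation.Unary.Any using (Any)
open import Data.Product using (_×_; _,_; proj₁; proj₂)
open import Relation.Nullary using (¬_; Dec)
open import Relation.Unary using (Pred; Decidable)
open import Relation.Binary.PropositionalEquality using (_≢_)
open import Level using (0ℓ)
open import Data.Fin.Subset.Properties using (nonempty?)
open import Data.Rational.Properties using (_≤?_)
open import Data.List.Relation.Unary.All using (all?)
open import Data.List.Relation.Unary.Any using (any?)
open import Relation.Nullary using (¬?; _×-dec_)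

ℕtoℚ : ℕ → ℚ
ℕtoℚ n = + n / 1

subsets : (n : ℕ) → List (Subset n)
subsets zero    = [] ∷ []
subsets (suc n) = map (true ∷_) (subsets n) ++ map (false ∷_) (subsets n)

kSubsets : (n k : ℕ) → List (Subset n)
kSubsets n k = filter (λ s → ∣ s ∣ ℕ.≟ k) (subsets n)

-- A k-uniform hypergraph on [n]: its list of hyperedges (a sublist of kSubsets n k).
Hypergraph : ℕ → Set
Hypergraph n = List (Subset n)

-- Outcomes of including each edge of the given list independently with
-- probability p, each paired with its probability.
outcomes : ∀ {n} → ℚ → List (Subset n) → List (Hypergraph n × ℚ)
outcomes p []       = ([] , 1ℚ) ∷ []
outcomes p (e ∷ es) =
  concatMap (λ o → (e ∷ proj₁ o , p * proj₂ o) ∷ (proj₁ o , (1ℚ - p) * proj₂ o) ∷ [])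
            (outcomes p es)

sumℚ : List ℚ → ℚ
sumℚ []       = 0ℚ
sumℚ (x ∷ xs) = x + sumℚ xs

Pr[H_k] : (k n : ℕ) (p : ℚ) (E : Pred (Hypergraph n) 0ℓ) → Decidable E → ℚ
Pr[H_k] k n p E E? =
  sumℚ (map proj₂ (filter (λ o → E? (proj₁ o)) (outcomes p (kSubsets n k))))

edgesMeeting : ∀ {n} → Hypergraph n → Subset n → ℕ
edgesMeeting H W = length (filter (λ e → 1 ℕ.≤? ∣ e ∩ W ∣) H)

BadSet : ∀ {n} → ℚ → Hypergraph n → Subset n → Set
BadSet {n} δ H W =
  Nonempty W
  × ℕtoℚ ∣ W ∣ ≤ δ * ℕtoℚ n
  × All (λ e → ∣ e ∩ W ∣ ≢ 1) H
  × ∣ W ∣ ℕ.≤ edgesMeeting H W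

ContainsBadSet : ∀ {n} → ℚ → Hypergraph n → Set
ContainsBadSet {n} δ H = Any (BadSet δ H) (subsets n)

containsBadSet? : ∀ {n} (δ : ℚ) → Decidable (ContainsBadSet {n} δ)
containsBadSet? {n} δ H = any? (λ W →
    nonempty? W
    ×-dec (ℕtoℚ ∣ W ∣ ≤? δ * ℕtoℚ n)
    ×-dec all? (λ e → ¬? (∣ e ∩ W ∣ ℕ.≟ 1)) H
    ×-dec (∣ W ∣ ℕ.≤? edgesMeeting H W)) (subsets n)

noBadSet? : ∀ {n} (δ : ℚ) → Decidable (λ (H : Hypergraph n) → ¬ ContainsBadSet δ H)
noBadSet? δ H = ¬? (containsBadSet? δ H)

-- Fix W with |W| = w. If W is bad, every k-set meeting W in exactly one vertex is absent
-- (there are w·C(n−w, k−1) of them), and at least w of the at most w²·n^(k−2) k-sets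
-- meeting W in two or more vertices are present; these edge sets are disjoint, so
--   Pr[W bad] ≤ (1−p)^(w·D) · C(w²n^(k−2), w) · p^w,   D = C(n−w, k−1).
-- Since C(n,w)·C(w²n^(k−2), w) ≤ (64·n^(k−1))^w, all W of size w together contribute at
-- most x^w with x = 64·n^(k−1)·(1−p)^D·p. As w ≤ δn, D ≥ n^(k−1)/K for a constant K, and
-- Bernoulli's inequality (1−p)^T·(1+Tp) ≤ 1 with T = D/2 gives x·p·n^(k−1) ≤ 64·(4K)².
-- So x → 0 as p·n^(k−1) → ∞, and the union bound is a geometric series in w ≥ 1.

module Submission where

module Embedding where
  open import Data.Nat as ℕ using (ℕ; zero; suc)
  import Data.Nat.Properties as ℕ
  import Data.Integer as ℤ
  import Data.Integer.Properties as ℤ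
  import Data.Nat.Coprimality as Coprime
  open import Data.Rational
  open import Data.Rational.Properties
  import Data.Rational.Unnormalised as ℚᵘ
  import Data.Rational.Unnormalised.Properties as ℚᵘ
  open import Data.Rational.Solver using (module +-*-Solver)
  open import Relation.Binary.PropositionalEquality
  open import Defs using (ℕtoℚ)
  open +-*-Solver

  ℕtoℚ≡mkℚ : ∀ n → ℕtoℚ n ≡ mkℚ (ℤ.+ n) 0 (Coprime.sym (Coprime.1-coprimeTo n))
  ℕtoℚ≡mkℚ n = normalize-coprime _

  ℕtoℚ-mono : ∀ {a b} → a ℕ.≤ b → ℕtoℚ a ≤ ℕtoℚ b
  ℕtoℚ-mono {a} {b} a≤b rewrite ℕtoℚ≡mkℚ a | ℕtoℚ≡mkℚ b =
    *≤* (ℤ.*-monoʳ-≤-nonNeg (ℤ.+ 1) (ℤ.+≤+ a≤b))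

  ℕtoℚ-cancel-≤ : ∀ {a b} → ℕtoℚ a ≤ ℕtoℚ b → a ℕ.≤ b
  ℕtoℚ-cancel-≤ {a} {b} a≤b rewrite ℕtoℚ≡mkℚ a | ℕtoℚ≡mkℚ b with drop-*≤* a≤b
  ... | a*1≤b*1 rewrite ℤ.*-identityʳ (ℤ.+ a) | ℤ.*-identityʳ (ℤ.+ b) = ℤ.drop‿+≤+ a*1≤b*1

  ℕtoℚ-cancel-< : ∀ {a b} → ℕtoℚ a < ℕtoℚ b → a ℕ.< b
  ℕtoℚ-cancel-< {a} {b} a<b = ℕ.≰⇒> λ b≤a → <-irrefl refl (<-≤-trans a<b (ℕtoℚ-mono b≤a))

  ℕtoℚ-nonNeg : ∀ n → 0ℚ ≤ ℕtoℚ n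
  ℕtoℚ-nonNeg n = ℕtoℚ-mono {0} {n} ℕ.z≤n

  ℕtoℚ-pos : ∀ n → 0ℚ < ℕtoℚ (suc n)
  ℕtoℚ-pos n rewrite ℕtoℚ≡mkℚ (suc n) = *<* (ℤ.+<+ (ℕ.s≤s ℕ.z≤n))

  ℕtoℚ-suc : ∀ n → ℕtoℚ (suc n) ≡ 1ℚ + ℕtoℚ n
  ℕtoℚ-suc n = toℚᵘ-injective (ℚᵘ.≃-trans suc≃1+n (ℚᵘ.≃-sym (toℚᵘ-homo-+ 1ℚ (ℕtoℚ n))))
    where
    suc≃1+n : toℚᵘ (ℕtoℚ (suc n)) ℚᵘ.≃ toℚᵘ 1ℚ ℚᵘ.+ toℚᵘ (ℕtoℚ n)
    suc≃1+n rewrite ℕtoℚ≡mkℚ n | ℕtoℚ≡mkℚ (suc n) =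
      ℚᵘ.*≡* (cong (ℤ._* ℤ.+ 1) (sym (cong (λ z → ℤ.+ 1 ℤ.+ z)
        (trans (ℤ.+◃n≡+n (n ℕ.* 1)) (cong ℤ.+_ (ℕ.*-identityʳ n))))))

  ℕtoℚ-+ : ∀ a b → ℕtoℚ (a ℕ.+ b) ≡ ℕtoℚ a + ℕtoℚ b
  ℕtoℚ-+ zero    b = sym (+-identityˡ (ℕtoℚ b))
  ℕtoℚ-+ (suc a) b = begin
    ℕtoℚ (suc (a ℕ.+ b))   ≡⟨ ℕtoℚ-suc (a ℕ.+ b) ⟩
    1ℚ + ℕtoℚ (a ℕ.+ b)    ≡⟨ cong (1ℚ +_) (ℕtoℚ-+ a b) ⟩
    1ℚ + (ℕtoℚ a + ℕtoℚ b) ≡⟨ +-assoc 1ℚ (ℕtoℚ a) (ℕtoℚ b) ⟨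
    1ℚ + ℕtoℚ a + ℕtoℚ b   ≡⟨ cong (_+ ℕtoℚ b) (ℕtoℚ-suc a) ⟨
    ℕtoℚ (suc a) + ℕtoℚ b  ∎
    where open ≡-Reasoning

  ℕtoℚ-* : ∀ a b → ℕtoℚ (a ℕ.* b) ≡ ℕtoℚ a * ℕtoℚ b
  ℕtoℚ-* zero    b = sym (*-zeroˡ (ℕtoℚ b))
  ℕtoℚ-* (suc a) b = begin
    ℕtoℚ (b ℕ.+ a ℕ.* b)      ≡⟨ ℕtoℚ-+ b (a ℕ.* b) ⟩
    ℕtoℚ b + ℕtoℚ (a ℕ.* b)   ≡⟨ cong (ℕtoℚ b +_) (ℕtoℚ-* a b) ⟩
    ℕtoℚ b + ℕtoℚ a * ℕtoℚ b  ≡⟨ solve 2 (λ x y → y :+ x :* y := (con 1ℚ :+ x) :* y) refl (ℕtoℚ a) (ℕtoℚ b) ⟩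
    (1ℚ + ℕtoℚ a) * ℕtoℚ b    ≡⟨ cong (_* ℕtoℚ b) (ℕtoℚ-suc a) ⟨
    ℕtoℚ (suc a) * ℕtoℚ b     ∎
    where open ≡-Reasoning

  *-monoˡ-≤-0≤ : ∀ {r p q} → 0ℚ ≤ r → p ≤ q → r * p ≤ r * q
  *-monoˡ-≤-0≤ {r} 0≤r = *-monoˡ-≤-nonNeg r {{nonNegative 0≤r}}

  *-monoʳ-≤-0≤ : ∀ {r p q} → 0ℚ ≤ r → p ≤ q → p * r ≤ q * r
  *-monoʳ-≤-0≤ {r} 0≤r = *-monoʳ-≤-nonNeg r {{nonNegative 0≤r}}

  *-mono-≤-0≤ : ∀ {a b c d} → 0ℚ ≤ b → 0ℚ ≤ c → a ≤ b → c ≤ d → a * c ≤ b * d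
  *-mono-≤-0≤ 0≤b 0≤c a≤b c≤d = ≤-trans (*-monoʳ-≤-0≤ 0≤c a≤b) (*-monoˡ-≤-0≤ 0≤b c≤d)

  0≤* : ∀ {a b} → 0ℚ ≤ a → 0ℚ ≤ b → 0ℚ ≤ a * b
  0≤* {a} {b} 0≤a 0≤b = ≤-trans (≤-reflexive (sym (*-zeroˡ b))) (*-monoʳ-≤-0≤ 0≤b 0≤a)

  0≤+ : ∀ {a b} → 0ℚ ≤ a → 0ℚ ≤ b → 0ℚ ≤ a + b
  0≤+ = +-mono-≤

  0≤1 : 0ℚ ≤ 1ℚ
  0≤1 = nonNegative⁻¹ 1ℚ

  x≤y+x : ∀ {x y} → 0ℚ ≤ y → x ≤ y + x
  x≤y+x {x} 0≤y = ≤-trans (≤-reflexive (sym (+-identityˡ x))) (+-monoˡ-≤ x 0≤y)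

  x-y≤x : ∀ x {y} → 0ℚ ≤ y → x - y ≤ x
  x-y≤x x 0≤y = ≤-trans (+-monoʳ-≤ x (neg-antimono-≤ 0≤y)) (≤-reflexive (+-identityʳ x))

  0≤1-p : ∀ {p} → p ≤ 1ℚ → 0ℚ ≤ 1ℚ - p
  0≤1-p {p} p≤1 = ≤-trans (≤-reflexive (sym (+-inverseʳ p))) (+-monoˡ-≤ (- p) p≤1)

  1-p≤1 : ∀ {p} → 0ℚ ≤ p → 1ℚ - p ≤ 1ℚ
  1-p≤1 0≤p = x-y≤x 1ℚ 0≤p

module Power where
  open import Data.Nat as ℕ using (ℕ; zero; suc)
  import Data.Nat.Properties as ℕ
  open import Data.Product using (_,_)
  open import Data.Rational
  open import Data.Rational.Properties
  open import Data.Rational.Solver using (module +-*-Solver)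
  open import Relation.Binary.PropositionalEquality
  open import Algebra.Bundles using (CommutativeRing)
  open import Algebra.Properties.CommutativeSemiring.Exp
    (CommutativeRing.commutativeSemiring +-*-commutativeRing) public
    using (_^_; ^-homo-*; ^-assocʳ; ^-distrib-*)
  open import Defs using (ℕtoℚ)
  open Embedding
  open +-*-Solver

  ^-nonNeg : ∀ {x} n → 0ℚ ≤ x → 0ℚ ≤ x ^ n
  ^-nonNeg zero    0≤x = 0≤1
  ^-nonNeg (suc n) 0≤x = 0≤* 0≤x (^-nonNeg n 0≤x)

  ^-monoˡ-≤ : ∀ {x y} n → 0ℚ ≤ x → x ≤ y → x ^ n ≤ y ^ n
  ^-monoˡ-≤ zero    0≤x x≤y = ≤-refl
  ^-monoˡ-≤ (suc n) 0≤x x≤y =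
    *-mono-≤-0≤ (≤-trans 0≤x x≤y) (^-nonNeg n 0≤x) x≤y (^-monoˡ-≤ n 0≤x x≤y)

  ^-≤1 : ∀ {x} n → 0ℚ ≤ x → x ≤ 1ℚ → x ^ n ≤ 1ℚ
  ^-≤1 n 0≤x x≤1 = ≤-trans (^-monoˡ-≤ n 0≤x x≤1) (≤-reflexive (1^n≡1 n))
    where
    1^n≡1 : ∀ n → 1ℚ ^ n ≡ 1ℚ
    1^n≡1 zero    = refl
    1^n≡1 (suc n) = trans (*-identityˡ (1ℚ ^ n)) (1^n≡1 n)

  ^-antitoneʳ : ∀ {x a b} → 0ℚ ≤ x → x ≤ 1ℚ → a ℕ.≤ b → x ^ b ≤ x ^ a
  ^-antitoneʳ {x} {a} 0≤x x≤1 a≤b with ℕ.m≤n⇒∃[o]m+o≡n a≤b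
  ... | d , refl rewrite ^-homo-* x a d =
    ≤-trans (*-monoˡ-≤-0≤ (^-nonNeg a 0≤x) (^-≤1 d 0≤x x≤1)) (≤-reflexive (*-identityʳ (x ^ a)))

  ℕtoℚ-^ : ∀ a n → ℕtoℚ (a ℕ.^ n) ≡ ℕtoℚ a ^ n
  ℕtoℚ-^ a zero    = refl
  ℕtoℚ-^ a (suc n) = trans (ℕtoℚ-* a (a ℕ.^ n)) (cong (ℕtoℚ a *_) (ℕtoℚ-^ a n))

  bernoulli : ∀ {p} T → 0ℚ ≤ p → p ≤ 1ℚ → (1ℚ - p) ^ T * (1ℚ + ℕtoℚ T * p) ≤ 1ℚ
  bernoulli {p} zero    0≤p p≤1 =
    ≤-reflexive (solve 1 (λ p → con 1ℚ :* (con 1ℚ :+ con 0ℚ :* p) := con 1ℚ) refl p)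
  bernoulli {p} (suc T) 0≤p p≤1 = begin
    (1ℚ - p) * Q * (1ℚ + ℕtoℚ (suc T) * p)  ≡⟨ cong (λ z → (1ℚ - p) * Q * (1ℚ + z * p)) (ℕtoℚ-suc T) ⟩
    (1ℚ - p) * Q * (1ℚ + (1ℚ + t) * p)      ≡⟨ solve 3 (λ p Q t →
        (con 1ℚ :- p) :* Q :* (con 1ℚ :+ (con 1ℚ :+ t) :* p)
          := Q :* (con 1ℚ :+ t :* p) :- Q :* (p :* (p :+ t :* p))) refl p Q t ⟩
    Q * (1ℚ + t * p) - Q * (p * (p + t * p)) ≤⟨ x-y≤x _ (0≤* (^-nonNeg T (0≤1-p p≤1))
                                                 (0≤* 0≤p (0≤+ 0≤p (0≤* (ℕtoℚ-nonNeg T) 0≤p)))) ⟩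
    Q * (1ℚ + t * p)                          ≤⟨ bernoulli T 0≤p p≤1 ⟩
    1ℚ                                        ∎
    where
    open ≤-Reasoning
    Q : ℚ
    Q = (1ℚ - p) ^ T
    t : ℚ
    t = ℕtoℚ T

module Binomial where
  open import Data.Nat
  open import Data.Nat.Properties
  open import Data.Nat.Combinatorics using (_C_; nC1≡n)
    renaming (nCk+nC[k+1]≡[n+1]C[k+1] to pascal)
  open import Data.Nat.Solver using (module +-*-Solver)
  open import Data.Product using (∃; _,_)
  open import Data.Sum using (_⊎_; inj₁; inj₂)
  open import Relation.Binary.PropositionalEquality
  open +-*-Solver

  C-monoˡ-≤ : ∀ {m m′} k → m ≤ m′ → (m C k) ≤ (m′ C k)
  C-monoˡ-≤ {m} k m≤m′ with m≤n⇒∃[o]m+o≡n m≤m′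
  ... | t , refl = go t
    where
    step : ∀ m k → (m C k) ≤ (suc m C k)
    step m zero    = ≤-refl
    step m (suc k) = ≤-trans (m≤n+m (m C suc k) (m C k)) (≤-reflexive (pascal m k))
    go : ∀ t → (m C k) ≤ ((m + t) C k)
    go zero    rewrite +-identityʳ m = ≤-refl
    go (suc t) rewrite +-suc m t = ≤-trans (go t) (step (m + t) k)

  [1+n]C[1+k]*[1+k]≡[1+n]*nCk : ∀ n k → (suc n C suc k) * suc k ≡ suc n * (n C k)
  [1+n]C[1+k]*[1+k]≡[1+n]*nCk zero    zero    = refl
  [1+n]C[1+k]*[1+k]≡[1+n]*nCk zero    (suc k) = refl
  [1+n]C[1+k]*[1+k]≡[1+n]*nCk (suc n) zero    = begin
    (suc (suc n) C 1) * 1 ≡⟨ *-identityʳ (suc (suc n) C 1) ⟩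
    (suc (suc n) C 1)     ≡⟨ nC1≡n (suc (suc n)) ⟩
    suc (suc n)           ≡⟨ *-identityʳ (suc (suc n)) ⟨
    suc (suc n) * 1       ∎
    where open ≡-Reasoning
  [1+n]C[1+k]*[1+k]≡[1+n]*nCk (suc n) (suc k) = begin
    (suc (suc n) C suc (suc k)) * suc (suc k)
      ≡⟨ cong (_* suc (suc k)) (pascal (suc n) (suc k)) ⟨
    (c + (suc n C suc (suc k))) * suc (suc k)
      ≡⟨ *-distribʳ-+ (suc (suc k)) c (suc n C suc (suc k)) ⟩
    c * suc (suc k) + (suc n C suc (suc k)) * suc (suc k)
      ≡⟨ cong (c * suc (suc k) +_) ([1+n]C[1+k]*[1+k]≡[1+n]*nCk n (suc k)) ⟩
    c * suc (suc k) + suc n * (n C suc k)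
      ≡⟨ solve 3 (λ x y z → x :* (con 2 :+ y) :+ z := x :+ (x :* (con 1 :+ y) :+ z)) refl c k (suc n * (n C suc k)) ⟩
    c + (c * suc k + suc n * (n C suc k))
      ≡⟨ cong (λ z → c + (z + suc n * (n C suc k))) ([1+n]C[1+k]*[1+k]≡[1+n]*nCk n k) ⟩
    c + (suc n * (n C k) + suc n * (n C suc k))
      ≡⟨ cong (c +_) (*-distribˡ-+ (suc n) (n C k) (n C suc k)) ⟨
    c + suc n * ((n C k) + (n C suc k))
      ≡⟨ cong (λ z → c + suc n * z) (pascal n k) ⟩
    suc (suc n) * c
      ∎
    where
    open ≡-Reasoning
    c : ℕ
    c = suc n C suc k

  [1+n∸k]^k≤k^k*nCk : ∀ n k → k ≤ n → suc (n ∸ k) ^ k ≤ k ^ k * (n C k)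
  [1+n∸k]^k≤k^k*nCk n       zero    _         = ≤-refl
  [1+n∸k]^k≤k^k*nCk (suc n) (suc k) (s≤s k≤n) = begin
    suc (n ∸ k) * suc (n ∸ k) ^ k   ≤⟨ *-mono-≤ (s≤s (m∸n≤m n k)) ([1+n∸k]^k≤k^k*nCk n k k≤n) ⟩
    suc n * (k ^ k * (n C k))       ≤⟨ *-monoʳ-≤ (suc n) (*-monoˡ-≤ (n C k) (^-monoˡ-≤ k (n≤1+n k))) ⟩
    suc n * (suc k ^ k * (n C k))   ≡⟨ solve 3 (λ a b c → a :* (b :* c) := b :* (a :* c)) refl (suc n) (suc k ^ k) (n C k) ⟩
    suc k ^ k * (suc n * (n C k))   ≡⟨ cong (suc k ^ k *_) ([1+n]C[1+k]*[1+k]≡[1+n]*nCk n k) ⟨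
    suc k ^ k * ((suc n C suc k) * suc k)
      ≡⟨ solve 3 (λ a b c → a :* (b :* c) := c :* a :* b) refl (suc k ^ k) (suc n C suc k) (suc k) ⟩
    suc k * suc k ^ k * (suc n C suc k) ∎
    where open ≤-Reasoning

  n^[1+k]+[1+k]*n^k≤[1+n]^[1+k] : ∀ n k → n ^ suc k + suc k * n ^ k ≤ suc n ^ suc k
  n^[1+k]+[1+k]*n^k≤[1+n]^[1+k] n zero    =
    ≤-reflexive (solve 1 (λ n → n :* con 1 :+ con 1 :* con 1 := (con 1 :+ n) :* con 1) refl n)
  n^[1+k]+[1+k]*n^k≤[1+n]^[1+k] n (suc k) = begin
    n * (n * n ^ k) + suc (suc k) * (n * n ^ k)
      ≤⟨ m≤m+n _ (suc k * n ^ k) ⟩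
    n * (n * n ^ k) + suc (suc k) * (n * n ^ k) + suc k * n ^ k
      ≡⟨ solve 3 (λ n x k → n :* (n :* x) :+ (con 2 :+ k) :* (n :* x) :+ (con 1 :+ k) :* x
                         := (con 1 :+ n) :* (n :* x :+ (con 1 :+ k) :* x)) refl n (n ^ k) k ⟩
    suc n * (n ^ suc k + suc k * n ^ k)
      ≤⟨ *-monoʳ-≤ (suc n) (n^[1+k]+[1+k]*n^k≤[1+n]^[1+k] n k) ⟩
    suc n * suc n ^ suc k ∎
    where open ≤-Reasoning

  nCk*k!≤n^k : ∀ n k → (n C k) * k ! ≤ n ^ k
  nCk*k!≤n^k zero    zero    = ≤-refl
  nCk*k!≤n^k zero    (suc k) = z≤n
  nCk*k!≤n^k (suc n) zero    = ≤-refl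
  nCk*k!≤n^k (suc n) (suc k) = begin
    (suc n C suc k) * (suc k * k !)
      ≡⟨ cong (_* (suc k * k !)) (pascal n k) ⟨
    ((n C k) + (n C suc k)) * (suc k * k !)
      ≡⟨ solve 4 (λ x y k f → (x :+ y) :* ((con 1 :+ k) :* f)
                           := (con 1 :+ k) :* (x :* f) :+ y :* ((con 1 :+ k) :* f)) refl (n C k) (n C suc k) k (k !) ⟩
    suc k * ((n C k) * k !) + (n C suc k) * suc k !
      ≤⟨ +-mono-≤ (*-monoʳ-≤ (suc k) (nCk*k!≤n^k n k)) (nCk*k!≤n^k n (suc k)) ⟩
    suc k * n ^ k + n ^ suc k
      ≡⟨ +-comm (suc k * n ^ k) (n ^ suc k) ⟩
    n ^ suc k + suc k * n ^ k
      ≤⟨ n^[1+k]+[1+k]*n^k≤[1+n]^[1+k] n k ⟩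
    suc n ^ suc k ∎
    where open ≤-Reasoning

  [1+n]^k*[n∸k]≤n^[1+k] : ∀ n k → k ≤ n → suc n ^ k * (n ∸ k) ≤ n ^ suc k
  [1+n]^k*[n∸k]≤n^[1+k] n zero    _   = ≤-reflexive (trans (+-identityʳ n) (sym (*-identityʳ n)))
  [1+n]^k*[n∸k]≤n^[1+k] n (suc k) k<n with m≤n⇒∃[o]m+o≡n k<n
  ... | t , refl = begin
    suc n′ ^ suc k * (n′ ∸ suc k) ≡⟨ cong (suc n′ ^ suc k *_) (m+n∸m≡n (suc k) t) ⟩
    suc n′ * suc n′ ^ k * t       ≡⟨ solve 3 (λ a b c → a :* b :* c := b :* (a :* c)) refl (suc n′) (suc n′ ^ k) t ⟩
    suc n′ ^ k * (suc n′ * t)     ≤⟨ *-monoʳ-≤ (suc n′ ^ k) [1+n]*t≤n*[n∸k] ⟩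
    suc n′ ^ k * (n′ * (n′ ∸ k))  ≡⟨ solve 3 (λ a b c → a :* (b :* c) := b :* (a :* c)) refl (suc n′ ^ k) n′ (n′ ∸ k) ⟩
    n′ * (suc n′ ^ k * (n′ ∸ k))  ≤⟨ *-monoʳ-≤ n′ ([1+n]^k*[n∸k]≤n^[1+k] n′ k (≤-trans (n≤1+n k) k<n)) ⟩
    n′ * n′ ^ suc k               ∎
    where
    open ≤-Reasoning
    n′ : ℕ
    n′ = suc k + t
    [1+n]*t≤n*[n∸k] : suc n′ * t ≤ n′ * (n′ ∸ k)
    [1+n]*t≤n*[n∸k] rewrite +-∸-assoc 1 (m≤m+n k t) | m+n∸m≡n k t =
      ≤-trans (m≤m+n (suc (suc k + t) * t) (suc k))
        (≤-reflexive (solve 2 (λ k t → (con 2 :+ k :+ t) :* t :+ (con 1 :+ k)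
                                    := (con 1 :+ k :+ t) :* (con 1 :+ t)) refl k t))

  [1+n]^k≤2*n^k : ∀ n k → k ≤ n → n ≤ 2 * (n ∸ k) → suc n ^ k ≤ 2 * n ^ k
  [1+n]^k≤2*n^k zero    zero k≤n _ = s≤s z≤n
  [1+n]^k≤2*n^k (suc m) k    k≤n n≤2[n∸k] = *-cancelʳ-≤ (suc n ^ k) (2 * n ^ k) n (begin
    suc n ^ k * n             ≤⟨ *-monoʳ-≤ (suc n ^ k) n≤2[n∸k] ⟩
    suc n ^ k * (2 * (n ∸ k)) ≡⟨ solve 2 (λ x y → x :* (con 2 :* y) := con 2 :* (x :* y)) refl (suc n ^ k) (n ∸ k) ⟩
    2 * (suc n ^ k * (n ∸ k)) ≤⟨ *-monoʳ-≤ 2 ([1+n]^k*[n∸k]≤n^[1+k] n k k≤n) ⟩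
    2 * (n * n ^ k)           ≡⟨ solve 2 (λ x y → con 2 :* (x :* y) := con 2 :* y :* x) refl n (n ^ k) ⟩
    2 * n ^ k * n             ∎)
    where
    open ≤-Reasoning
    n : ℕ
    n = suc m

  even-or-odd : ∀ n → ∃ λ a → n ≡ a + a ⊎ n ≡ suc (a + a)
  even-or-odd zero = 0 , inj₁ refl
  even-or-odd (suc n) with even-or-odd n
  ... | a , inj₁ refl = a , inj₂ refl
  ... | a , inj₂ refl = suc a , inj₁ (cong suc (sym (+-suc a a)))

  [1+n]^n≤8*n^n : ∀ n → suc n ^ n ≤ 8 * n ^ n
  [1+n]^n≤8*n^n n with even-or-odd n
  ... | a , inj₁ refl = begin
    suc (a + a) ^ (a + a)            ≡⟨ ^-distribˡ-+-* (suc (a + a)) a a ⟩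
    suc (a + a) ^ a * suc (a + a) ^ a ≤⟨ *-mono-≤ half-power half-power ⟩
    2 * (a + a) ^ a * (2 * (a + a) ^ a)
      ≡⟨ solve 1 (λ x → con 2 :* x :* (con 2 :* x) := con 4 :* (x :* x)) refl ((a + a) ^ a) ⟩
    4 * ((a + a) ^ a * (a + a) ^ a)   ≤⟨ *-monoˡ-≤ ((a + a) ^ a * (a + a) ^ a) (s≤s (s≤s (s≤s (s≤s (z≤n {4}))))) ⟩
    8 * ((a + a) ^ a * (a + a) ^ a)   ≡⟨ cong (8 *_) (^-distribˡ-+-* (a + a) a a) ⟨
    8 * (a + a) ^ (a + a)             ∎
    where
    open ≤-Reasoning
    half-power : suc (a + a) ^ a ≤ 2 * (a + a) ^ a
    half-power = [1+n]^k≤2*n^k (a + a) a (m≤m+n a a)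
      (≤-reflexive (trans (cong (a +_) (sym (+-identityʳ a))) (cong (2 *_) (sym (m+n∸m≡n a a)))))
  ... | a , inj₂ refl = begin
    suc m * suc m ^ (a + a)         ≡⟨ cong (suc m *_) (^-distribˡ-+-* (suc m) a a) ⟩
    suc m * (suc m ^ a * suc m ^ a) ≤⟨ *-mono-≤ 1+m≤2*m (*-mono-≤ half-power half-power) ⟩
    2 * m * (2 * m ^ a * (2 * m ^ a))
      ≡⟨ solve 2 (λ w x → con 2 :* w :* (con 2 :* x :* (con 2 :* x)) := con 8 :* (w :* (x :* x))) refl m (m ^ a) ⟩
    8 * (m * (m ^ a * m ^ a))       ≡⟨ cong (λ z → 8 * (m * z)) (^-distribˡ-+-* m a a) ⟨
    8 * m ^ suc (a + a)             ∎
    where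
    open ≤-Reasoning
    m : ℕ
    m = suc (a + a)
    1+m≤2*m : suc m ≤ 2 * m
    1+m≤2*m = ≤-trans (m<m*n m 2 (s≤s (s≤s z≤n))) (≤-reflexive (*-comm m 2))
    m≤2[m∸a] : m ≤ 2 * (m ∸ a)
    m≤2[m∸a] rewrite +-∸-assoc 1 (m≤m+n a a) | m+n∸m≡n a a =
      s≤s (+-monoʳ-≤ a (≤-trans (n≤1+n a) (s≤s (≤-reflexive (sym (+-identityʳ a))))))
    half-power : suc m ^ a ≤ 2 * m ^ a
    half-power = [1+n]^k≤2*n^k m a (≤-trans (m≤m+n a a) (n≤1+n (a + a))) m≤2[m∸a]

  n^n≤8^n*n! : ∀ n → n ^ n ≤ 8 ^ n * n !
  n^n≤8^n*n! zero    = ≤-refl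
  n^n≤8^n*n! (suc n) = begin
    suc n * suc n ^ n          ≤⟨ *-monoʳ-≤ (suc n) ([1+n]^n≤8*n^n n) ⟩
    suc n * (8 * n ^ n)        ≤⟨ *-monoʳ-≤ (suc n) (*-monoʳ-≤ 8 (n^n≤8^n*n! n)) ⟩
    suc n * (8 * (8 ^ n * n !)) ≡⟨ solve 3 (λ s x f → s :* (con 8 :* (x :* f)) := con 8 :* x :* (s :* f)) refl (suc n) (8 ^ n) (n !) ⟩
    8 * 8 ^ n * (suc n * n !)   ∎
    where open ≤-Reasoning

  ^-distribʳ-* : ∀ m n k → (m * n) ^ k ≡ m ^ k * n ^ k
  ^-distribʳ-* m n zero    = refl
  ^-distribʳ-* m n (suc k) rewrite ^-distribʳ-* m n k =
    solve 4 (λ a b x y → (a :* b) :* (x :* y) := (a :* x) :* (b :* y)) refl m n (m ^ k) (n ^ k)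

  nCk*[k²n^i]Ck≤[64*n^[1+i]]^k : ∀ n i k → (n C k) * ((k ^ 2 * n ^ i) C k) ≤ (64 * n ^ suc i) ^ k
  nCk*[k²n^i]Ck≤[64*n^[1+i]]^k n i k = *-cancelʳ-≤ _ _ (k ! * k !) {{k !* k !≢0}} (begin
    (n C k) * (M C k) * (k ! * k !)
      ≡⟨ solve 3 (λ x y f → x :* y :* (f :* f) := (x :* f) :* (y :* f)) refl (n C k) (M C k) (k !) ⟩
    (n C k) * k ! * ((M C k) * k !)
      ≤⟨ *-mono-≤ (nCk*k!≤n^k n k) (nCk*k!≤n^k M k) ⟩
    n ^ k * M ^ k
      ≡⟨ cong (n ^ k *_) (trans (cong (λ z → (k * z * n ^ i) ^ k) (*-identityʳ k))
                              (trans (^-distribʳ-* (k * k) (n ^ i) k) (cong (_* (n ^ i) ^ k) (^-distribʳ-* k k k)))) ⟩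
    n ^ k * (k ^ k * k ^ k * (n ^ i) ^ k)
      ≤⟨ *-monoʳ-≤ (n ^ k) (*-monoˡ-≤ ((n ^ i) ^ k) (*-mono-≤ (n^n≤8^n*n! k) (n^n≤8^n*n! k))) ⟩
    n ^ k * (8 ^ k * k ! * (8 ^ k * k !) * (n ^ i) ^ k)
      ≡⟨ solve 4 (λ a b f c → a :* (b :* f :* (b :* f) :* c) := (b :* b :* (a :* c)) :* (f :* f)) refl (n ^ k) (8 ^ k) (k !) ((n ^ i) ^ k) ⟩
    8 ^ k * 8 ^ k * (n ^ k * (n ^ i) ^ k) * (k ! * k !)
      ≡⟨ cong (_* (k ! * k !)) (trans (^-distribʳ-* 64 (n * n ^ i) k) (cong₂ _*_ (^-distribʳ-* 8 8 k) (^-distribʳ-* n (n ^ i) k))) ⟨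
    (64 * n ^ suc i) ^ k * (k ! * k !) ∎)
    where
    open ≤-Reasoning
    M : ℕ
    M = k ^ 2 * n ^ i

  n^j≤[2jr]^j*mCj : ∀ j r n m → n ≤ r * m → 2 * j ≤ m → n ^ j ≤ (2 * j * r) ^ j * (m C j)
  n^j≤[2jr]^j*mCj j r n m n≤rm 2j≤m = begin
    n ^ j                               ≤⟨ ^-monoˡ-≤ j n≤rm ⟩
    (r * m) ^ j                         ≡⟨ ^-distribʳ-* r m j ⟩
    r ^ j * m ^ j                       ≤⟨ *-monoʳ-≤ (r ^ j) (^-monoˡ-≤ j m≤2[1+m∸j]) ⟩
    r ^ j * (2 * suc (m ∸ j)) ^ j       ≡⟨ cong (r ^ j *_) (^-distribʳ-* 2 (suc (m ∸ j)) j) ⟩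
    r ^ j * (2 ^ j * suc (m ∸ j) ^ j)   ≤⟨ *-monoʳ-≤ (r ^ j) (*-monoʳ-≤ (2 ^ j) ([1+n∸k]^k≤k^k*nCk m j j≤m)) ⟩
    r ^ j * (2 ^ j * (j ^ j * (m C j))) ≡⟨ solve 4 (λ a b c d → a :* (b :* (c :* d)) := (b :* c :* a) :* d) refl (r ^ j) (2 ^ j) (j ^ j) (m C j) ⟩
    2 ^ j * j ^ j * r ^ j * (m C j)     ≡⟨ cong (_* (m C j)) (trans (^-distribʳ-* (2 * j) r j) (cong (_* r ^ j) (^-distribʳ-* 2 j j))) ⟨
    (2 * j * r) ^ j * (m C j)           ∎
    where
    open ≤-Reasoning
    j≤m : j ≤ m
    j≤m = ≤-trans (m≤m+n j (j + 0)) 2j≤m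
    m≤2[1+m∸j] : m ≤ 2 * suc (m ∸ j)
    m≤2[1+m∸j] with m≤n⇒∃[o]m+o≡n j≤m
    ... | t , refl rewrite m+n∸m≡n j t = begin
      j + t                     ≤⟨ +-monoˡ-≤ t j≤t ⟩
      t + t                     ≤⟨ +-mono-≤ (n≤1+n t) (≤-trans (n≤1+n t) (≤-reflexive (sym (+-identityʳ (suc t))))) ⟩
      suc t + (suc t + 0)       ∎
      where
      j≤t : j ≤ t
      j≤t = +-cancelˡ-≤ j j t (≤-trans (≤-reflexive (cong (j +_) (sym (+-identityʳ j)))) 2j≤m)

module Counting where
  open import Data.Nat
  open import Data.Nat.Properties
  open import Data.Nat.Combinatorics using (_C_) renaming (nCk+nC[k+1]≡[n+1]C[k+1] to pascal)
  open import Data.Bool using (Bool; true; false; _∧_; if_then_else_; T)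
  open import Data.Bool.Properties using (∧-comm; ∧-zeroʳ; ∧-identityʳ)
  open import Data.List using (List; []; _∷_; _++_; map; filter)
  open import Data.Vec using ([]; _∷_)
  open import Data.Fin.Subset using (Subset; ∣_∣; _∩_; ∁)
  open import Data.Fin.Subset.Properties using (∣p∩q∣≤∣p∣)
  open import Relation.Nullary using (does; yes; no; contradiction)
  open import Relation.Unary using (Pred; Decidable)
  open import Relation.Binary.PropositionalEquality
  open import Level using (0ℓ)
  open import Defs using (subsets; kSubsets)

  countᵇ : ∀ {A : Set} → (A → Bool) → List A → ℕ
  countᵇ f []       = 0
  countᵇ f (x ∷ xs) = if f x then suc (countᵇ f xs) else countᵇ f xs

  module _ {A : Set} where

    countᵇ-++ : ∀ (f : A → Bool) xs ys → countᵇ f (xs ++ ys) ≡ countᵇ f xs + countᵇ f ys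
    countᵇ-++ f []       ys = refl
    countᵇ-++ f (x ∷ xs) ys with f x
    ... | true  = cong suc (countᵇ-++ f xs ys)
    ... | false = countᵇ-++ f xs ys

    countᵇ-map : ∀ {B : Set} (f : B → Bool) (g : A → B) xs → countᵇ f (map g xs) ≡ countᵇ (λ x → f (g x)) xs
    countᵇ-map f g []       = refl
    countᵇ-map f g (x ∷ xs) rewrite countᵇ-map f g xs = refl

    countᵇ-cong : ∀ {f g : A → Bool} xs → (∀ x → f x ≡ g x) → countᵇ f xs ≡ countᵇ g xs
    countᵇ-cong []       f≗g = refl
    countᵇ-cong (x ∷ xs) f≗g rewrite f≗g x | countᵇ-cong xs f≗g = refl

    countᵇ-filter : ∀ {P : Pred A 0ℓ} (P? : Decidable P) (f : A → Bool) xs →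
                    countᵇ f (filter P? xs) ≡ countᵇ (λ x → does (P? x) ∧ f x) xs
    countᵇ-filter P? f []       = refl
    countᵇ-filter P? f (x ∷ xs) with P? x
    ... | no  _ = countᵇ-filter P? f xs
    ... | yes _ with f x
    ...   | true  = cong suc (countᵇ-filter P? f xs)
    ...   | false = countᵇ-filter P? f xs

    countᵇ-false : ∀ {f : A → Bool} xs → (∀ x → f x ≡ false) → countᵇ f xs ≡ 0
    countᵇ-false []       f≗false = refl
    countᵇ-false (x ∷ xs) f≗false rewrite f≗false x = countᵇ-false xs f≗false

    countᵇ-∷-true : ∀ {f : A → Bool} {x} xs → f x ≡ true → countᵇ f (x ∷ xs) ≡ suc (countᵇ f xs)
    countᵇ-∷-true xs fx≡true rewrite fx≡true = refl

    countᵇ-∷-false : ∀ {f : A → Bool} {x} xs → f x ≡ false → countᵇ f (x ∷ xs) ≡ countᵇ f xs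
    countᵇ-∷-false xs fx≡false rewrite fx≡false = refl

  countᵇ-subsets : ∀ {n} (f : Subset (suc n) → Bool) →
    countᵇ f (subsets (suc n)) ≡ countᵇ (λ s → f (true ∷ s)) (subsets n) + countᵇ (λ s → f (false ∷ s)) (subsets n)
  countᵇ-subsets {n} f
    rewrite countᵇ-++ f (map (true ∷_) (subsets n)) (map (false ∷_) (subsets n))
          | countᵇ-map f (true ∷_) (subsets n) | countᵇ-map f (false ∷_) (subsets n) = refl

  sized : ∀ {n} → (Subset n → Bool) → ℕ → Subset n → Bool
  sized f k s = f s ∧ (∣ s ∣ ≡ᵇ k)

  countᵇ-kSubsets : ∀ {n} k (f : Subset n → Bool) → countᵇ f (kSubsets n k) ≡ countᵇ (sized f k) (subsets n)
  countᵇ-kSubsets {n} k f = trans (countᵇ-filter (λ s → ∣ s ∣ ≟ k) f (subsets n))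
    (countᵇ-cong (subsets n) (λ s → ∧-comm (∣ s ∣ ≡ᵇ k) (f s)))

  count-disjoint : ∀ {n} (W : Subset n) k →
    countᵇ (sized (λ s → ∣ s ∩ W ∣ ≡ᵇ 0) k) (subsets n) ≡ (∣ ∁ W ∣ C k)
  count-disjoint         []          zero    = refl
  count-disjoint         []          (suc k) = refl
  count-disjoint {suc n} (true ∷ W)  k       = trans (countᵇ-subsets (sized (λ s → ∣ s ∩ (true ∷ W) ∣ ≡ᵇ 0) k))
    (cong₂ _+_ (countᵇ-false (subsets n) (λ _ → refl)) (count-disjoint W k))
  count-disjoint {suc n} (false ∷ W) zero    = trans (countᵇ-subsets (sized (λ s → ∣ s ∩ (false ∷ W) ∣ ≡ᵇ 0) zero))
    (cong₂ _+_ (countᵇ-false (subsets n) (λ s → ∧-zeroʳ (∣ s ∩ W ∣ ≡ᵇ 0))) (count-disjoint W zero))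
  count-disjoint {suc n} (false ∷ W) (suc k) = begin
    countᵇ (sized (λ s → ∣ s ∩ (false ∷ W) ∣ ≡ᵇ 0) (suc k)) (subsets (suc n))
      ≡⟨ countᵇ-subsets (sized (λ s → ∣ s ∩ (false ∷ W) ∣ ≡ᵇ 0) (suc k)) ⟩
    countᵇ (sized (λ s → ∣ s ∩ W ∣ ≡ᵇ 0) k) (subsets n) + countᵇ (sized (λ s → ∣ s ∩ W ∣ ≡ᵇ 0) (suc k)) (subsets n)
      ≡⟨ cong₂ _+_ (count-disjoint W k) (count-disjoint W (suc k)) ⟩
    (∣ ∁ W ∣ C k) + (∣ ∁ W ∣ C suc k)
      ≡⟨ pascal ∣ ∁ W ∣ k ⟩
    (suc ∣ ∁ W ∣ C suc k) ∎
    where open ≡-Reasoning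

  count-meetsOnce : ∀ {n} (W : Subset n) k →
    countᵇ (sized (λ s → ∣ s ∩ W ∣ ≡ᵇ 1) (suc k)) (subsets n) ≡ ∣ W ∣ * (∣ ∁ W ∣ C k)
  count-meetsOnce         []          k       = refl
  count-meetsOnce {suc n} (true ∷ W)  k       =
    trans (countᵇ-subsets (sized (λ s → ∣ s ∩ (true ∷ W) ∣ ≡ᵇ 1) (suc k)))
      (cong₂ _+_ (count-disjoint W k) (count-meetsOnce W k))
  count-meetsOnce {suc n} (false ∷ W) zero    =
    trans (countᵇ-subsets (sized (λ s → ∣ s ∩ (false ∷ W) ∣ ≡ᵇ 1) 1))
      (cong₂ _+_ (countᵇ-false (subsets n) meetsOnce-empty) (count-meetsOnce W zero))
    where
    meetsOnce-empty : ∀ s → (∣ s ∩ W ∣ ≡ᵇ 1) ∧ (∣ s ∣ ≡ᵇ 0) ≡ false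
    meetsOnce-empty s with ∣ s ∣ | ∣p∩q∣≤∣p∣ s W
    ... | zero  | ∣s∩W∣≤0 rewrite n≤0⇒n≡0 ∣s∩W∣≤0 = refl
    ... | suc _ | _       = ∧-zeroʳ (∣ s ∩ W ∣ ≡ᵇ 1)
  count-meetsOnce {suc n} (false ∷ W) (suc k) = begin
    countᵇ (sized (λ s → ∣ s ∩ (false ∷ W) ∣ ≡ᵇ 1) (suc (suc k))) (subsets (suc n))
      ≡⟨ countᵇ-subsets (sized (λ s → ∣ s ∩ (false ∷ W) ∣ ≡ᵇ 1) (suc (suc k))) ⟩
    countᵇ (sized (λ s → ∣ s ∩ W ∣ ≡ᵇ 1) (suc k)) (subsets n)
      + countᵇ (sized (λ s → ∣ s ∩ W ∣ ≡ᵇ 1) (suc (suc k))) (subsets n)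
      ≡⟨ cong₂ _+_ (count-meetsOnce W k) (count-meetsOnce W (suc k)) ⟩
    ∣ W ∣ * (∣ ∁ W ∣ C k) + ∣ W ∣ * (∣ ∁ W ∣ C suc k)
      ≡⟨ *-distribˡ-+ ∣ W ∣ (∣ ∁ W ∣ C k) (∣ ∁ W ∣ C suc k) ⟨
    ∣ W ∣ * ((∣ ∁ W ∣ C k) + (∣ ∁ W ∣ C suc k))
      ≡⟨ cong (∣ W ∣ *_) (pascal ∣ ∁ W ∣ k) ⟩
    ∣ W ∣ * (suc ∣ ∁ W ∣ C suc k) ∎
    where open ≡-Reasoning

  ≤ᵇ-suc : ∀ j m → (suc j ≤ᵇ suc m) ≡ (j ≤ᵇ m)
  ≤ᵇ-suc zero    m = refl
  ≤ᵇ-suc (suc j) m = refl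

  ≤ᵇ-false : ∀ {m n} → n < m → (m ≤ᵇ n) ≡ false
  ≤ᵇ-false {m} {n} n<m with m ≤ᵇ n in eq
  ... | false = refl
  ... | true  = contradiction (≤ᵇ⇒≤ m n (subst T (sym eq) _)) (<⇒≱ n<m)

  count-meets≥-zero : ∀ {n} (W : Subset n) j k → k < j → countᵇ (sized (λ s → j ≤ᵇ ∣ s ∩ W ∣) k) (subsets n) ≡ 0
  count-meets≥-zero {n} W j k k<j = countᵇ-false (subsets n) no-large-meeting
    where
    no-large-meeting : ∀ s → (j ≤ᵇ ∣ s ∩ W ∣) ∧ (∣ s ∣ ≡ᵇ k) ≡ false
    no-large-meeting s with ∣ s ∣ ≡ᵇ k in eq
    ... | false = ∧-zeroʳ (j ≤ᵇ ∣ s ∩ W ∣)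
    ... | true  = trans (∧-identityʳ _) (≤ᵇ-false (≤-<-trans (∣p∩q∣≤∣p∣ s W)
                    (subst (_< j) (sym (≡ᵇ⇒≡ ∣ s ∣ k (subst T (sym eq) _))) k<j)))

  n^k+n^[1+k]≤[1+n]^[1+k] : ∀ n k → n ^ k + n ^ suc k ≤ suc n ^ suc k
  n^k+n^[1+k]≤[1+n]^[1+k] n k = +-mono-≤ (^-monoˡ-≤ k (n≤1+n n)) (*-monoʳ-≤ n (^-monoˡ-≤ k (n≤1+n n)))

  count-meets≥ : ∀ {n} (W : Subset n) j k → j ≤ k →
    countᵇ (sized (λ s → j ≤ᵇ ∣ s ∩ W ∣) k) (subsets n) ≤ ∣ W ∣ ^ j * n ^ (k ∸ j)
  count-meets≥         []          zero    zero    _   = ≤-refl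
  count-meets≥         []          zero    (suc k) _   = z≤n
  count-meets≥         []          (suc j) (suc k) _   = z≤n
  count-meets≥ {suc n} (b ∷ W)     zero    zero    _   = ≤-trans
    (≤-reflexive (trans (countᵇ-subsets (sized (λ s → 0 ≤ᵇ ∣ s ∩ (b ∷ W) ∣) 0))
                        (cong₂ _+_ (countᵇ-false (subsets n) (λ _ → refl)) refl)))
    (count-meets≥ W 0 0 z≤n)
  count-meets≥ {suc n} (true ∷ W)  zero    (suc k) _   = begin
    countᵇ (sized (λ s → 0 ≤ᵇ ∣ s ∩ (true ∷ W) ∣) (suc k)) (subsets (suc n))
      ≡⟨ countᵇ-subsets (sized (λ s → 0 ≤ᵇ ∣ s ∩ (true ∷ W) ∣) (suc k)) ⟩
    countᵇ (sized (λ s → 0 ≤ᵇ ∣ s ∩ W ∣) k) (subsets n) + countᵇ (sized (λ s → 0 ≤ᵇ ∣ s ∩ W ∣) (suc k)) (subsets n)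
      ≤⟨ +-mono-≤ (count-meets≥ W 0 k z≤n) (count-meets≥ W 0 (suc k) z≤n) ⟩
    1 * n ^ k + 1 * n ^ suc k
      ≡⟨ cong₂ _+_ (*-identityˡ (n ^ k)) (*-identityˡ (n ^ suc k)) ⟩
    n ^ k + n ^ suc k
      ≤⟨ n^k+n^[1+k]≤[1+n]^[1+k] n k ⟩
    suc n ^ suc k
      ≡⟨ *-identityˡ (suc n ^ suc k) ⟨
    1 * suc n ^ suc k ∎
    where open ≤-Reasoning
  count-meets≥ {suc n} (true ∷ W)  (suc j) (suc k) (s≤s j≤k) = begin
    countᵇ (sized (λ s → suc j ≤ᵇ ∣ s ∩ (true ∷ W) ∣) (suc k)) (subsets (suc n))
      ≡⟨ countᵇ-subsets (sized (λ s → suc j ≤ᵇ ∣ s ∩ (true ∷ W) ∣) (suc k)) ⟩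
    countᵇ (sized (λ s → suc j ≤ᵇ suc ∣ s ∩ W ∣) k) (subsets n)
      + countᵇ (sized (λ s → suc j ≤ᵇ ∣ s ∩ W ∣) (suc k)) (subsets n)
      ≡⟨ cong₂ _+_ (countᵇ-cong (subsets n) (λ s → cong (_∧ (∣ s ∣ ≡ᵇ k)) (≤ᵇ-suc j ∣ s ∩ W ∣))) refl ⟩
    countᵇ (sized (λ s → j ≤ᵇ ∣ s ∩ W ∣) k) (subsets n)
      + countᵇ (sized (λ s → suc j ≤ᵇ ∣ s ∩ W ∣) (suc k)) (subsets n)
      ≤⟨ +-mono-≤ (count-meets≥ W j k j≤k) (count-meets≥ W (suc j) (suc k) (s≤s j≤k)) ⟩
    w ^ j * n ^ (k ∸ j) + w * w ^ j * n ^ (k ∸ j)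
      ≡⟨ *-distribʳ-+ (n ^ (k ∸ j)) (w ^ j) (w * w ^ j) ⟨
    (w ^ j + w * w ^ j) * n ^ (k ∸ j)
      ≤⟨ *-mono-≤ (+-mono-≤ (^-monoˡ-≤ j (n≤1+n w)) (*-monoʳ-≤ w (^-monoˡ-≤ j (n≤1+n w))))
                  (^-monoˡ-≤ (k ∸ j) (n≤1+n n)) ⟩
    suc w ^ suc j * suc n ^ (k ∸ j) ∎
    where
    open ≤-Reasoning
    w : ℕ
    w = ∣ W ∣
  count-meets≥ {suc n} (false ∷ W) j       (suc k) j≤1+k with j ≤? k
  ... | yes j≤k = begin
    countᵇ (sized (λ s → j ≤ᵇ ∣ s ∩ (false ∷ W) ∣) (suc k)) (subsets (suc n))
      ≡⟨ countᵇ-subsets (sized (λ s → j ≤ᵇ ∣ s ∩ (false ∷ W) ∣) (suc k)) ⟩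
    countᵇ (sized (λ s → j ≤ᵇ ∣ s ∩ W ∣) k) (subsets n) + countᵇ (sized (λ s → j ≤ᵇ ∣ s ∩ W ∣) (suc k)) (subsets n)
      ≤⟨ +-mono-≤ (count-meets≥ W j k j≤k) (count-meets≥ W j (suc k) j≤1+k) ⟩
    w ^ j * n ^ (k ∸ j) + w ^ j * n ^ (suc k ∸ j)
      ≡⟨ cong (λ e → w ^ j * n ^ (k ∸ j) + w ^ j * n ^ e) (+-∸-assoc 1 j≤k) ⟩
    w ^ j * n ^ (k ∸ j) + w ^ j * n ^ suc (k ∸ j)
      ≡⟨ *-distribˡ-+ (w ^ j) (n ^ (k ∸ j)) (n ^ suc (k ∸ j)) ⟨
    w ^ j * (n ^ (k ∸ j) + n ^ suc (k ∸ j))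
      ≤⟨ *-monoʳ-≤ (w ^ j) (n^k+n^[1+k]≤[1+n]^[1+k] n (k ∸ j)) ⟩
    w ^ j * suc n ^ suc (k ∸ j)
      ≡⟨ cong (λ e → w ^ j * suc n ^ e) (+-∸-assoc 1 j≤k) ⟨
    w ^ j * suc n ^ (suc k ∸ j) ∎
    where
    open ≤-Reasoning
    w : ℕ
    w = ∣ W ∣
  ... | no j≰k = begin
    countᵇ (sized (λ s → j ≤ᵇ ∣ s ∩ (false ∷ W) ∣) (suc k)) (subsets (suc n))
      ≡⟨ countᵇ-subsets (sized (λ s → j ≤ᵇ ∣ s ∩ (false ∷ W) ∣) (suc k)) ⟩
    countᵇ (sized (λ s → j ≤ᵇ ∣ s ∩ W ∣) k) (subsets n) + countᵇ (sized (λ s → j ≤ᵇ ∣ s ∩ W ∣) (suc k)) (subsets n)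
      ≡⟨ cong₂ _+_ (count-meets≥-zero W j k (≰⇒> j≰k)) refl ⟩
    countᵇ (sized (λ s → j ≤ᵇ ∣ s ∩ W ∣) (suc k)) (subsets n)
      ≤⟨ count-meets≥ W j (suc k) j≤1+k ⟩
    ∣ W ∣ ^ j * n ^ (suc k ∸ j)
      ≤⟨ *-monoʳ-≤ (∣ W ∣ ^ j) (^-monoˡ-≤ (suc k ∸ j) (n≤1+n n)) ⟩
    ∣ W ∣ ^ j * suc n ^ (suc k ∸ j) ∎
    where open ≤-Reasoning

module Distribution where
  open import Data.Nat using (ℕ)
  open import Data.Rational
  open import Data.Rational.Properties
  open import Data.Rational.Solver using (module +-*-Solver)
  open import Data.List using (List; []; _∷_; map; filter; concatMap)
  open import Data.List.Relation.Unary.All using (All; []; _∷_)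
  open import Data.List.Relation.Unary.Any using (here; there; any?)
  open import Data.Product using (_×_; _,_; proj₁; proj₂)
  open import Data.Sum using (_⊎_; inj₁; inj₂)
  open import Data.Unit using (⊤; tt)
  open import Relation.Nullary using (¬_; Dec; yes; no; ¬?; contradiction)
  open import Relation.Unary using (Pred; Decidable)
  open import Relation.Binary.PropositionalEquality
  open import Level using (0ℓ)
  open import Data.Fin.Subset using (Subset)
  open import Defs using (Hypergraph; outcomes; sumℚ)
  open Embedding
  open +-*-Solver

  module _ {n : ℕ} where

    Outcomes : Set
    Outcomes = List (Hypergraph n × ℚ)

    Event : Set₁
    Event = Pred (Hypergraph n) 0ℓ

    mass : {E : Event} → Decidable E → Outcomes → ℚ
    mass E? O = sumℚ (map proj₂ (filter (λ o → E? (proj₁ o)) O))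

    total : Outcomes → ℚ
    total = mass {E = λ _ → ⊤} (λ _ → yes tt)

    NonNegWeights : Outcomes → Set
    NonNegWeights = All (λ o → 0ℚ ≤ proj₂ o)

    mass-∷-yes : ∀ {E : Event} (E? : Decidable E) o O → E (proj₁ o) → mass E? (o ∷ O) ≡ proj₂ o + mass E? O
    mass-∷-yes E? o O e with E? (proj₁ o)
    ... | yes _  = refl
    ... | no  ¬e = contradiction e ¬e

    mass-∷-no : ∀ {E : Event} (E? : Decidable E) o O → ¬ E (proj₁ o) → mass E? (o ∷ O) ≡ mass E? O
    mass-∷-no E? o O ¬e with E? (proj₁ o)
    ... | yes e = contradiction e ¬e
    ... | no  _ = refl

    mass-nonNeg : ∀ {E : Event} (E? : Decidable E) O → NonNegWeights O → 0ℚ ≤ mass E? O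
    mass-nonNeg E? []      _          = ≤-refl
    mass-nonNeg E? (o ∷ O) (0≤o ∷ 0≤O) with E? (proj₁ o)
    ... | yes _ = 0≤+ 0≤o (mass-nonNeg E? O 0≤O)
    ... | no  _ = mass-nonNeg E? O 0≤O

    mass-mono : ∀ {E F : Event} (E? : Decidable E) (F? : Decidable F) O → NonNegWeights O →
                (∀ H → E H → F H) → mass E? O ≤ mass F? O
    mass-mono E? F? []      _           E⊆F = ≤-refl
    mass-mono E? F? (o ∷ O) (0≤o ∷ 0≤O) E⊆F with E? (proj₁ o) | F? (proj₁ o)
    ... | yes _ | yes _ = +-monoʳ-≤ (proj₂ o) (mass-mono E? F? O 0≤O E⊆F)
    ... | yes e | no ¬f = contradiction (E⊆F _ e) ¬f
    ... | no  _ | yes _ = ≤-trans (mass-mono E? F? O 0≤O E⊆F) (x≤y+x 0≤o)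
    ... | no  _ | no  _ = mass-mono E? F? O 0≤O E⊆F

    mass-∅ : ∀ {E : Event} (E? : Decidable E) O → (∀ H → ¬ E H) → mass E? O ≡ 0ℚ
    mass-∅ E? []      E≡∅ = refl
    mass-∅ E? (o ∷ O) E≡∅ = trans (mass-∷-no E? o O (E≡∅ _)) (mass-∅ E? O E≡∅)

    mass-subadditive : ∀ {E F G : Event} (E? : Decidable E) (F? : Decidable F) (G? : Decidable G) O →
                       NonNegWeights O → (∀ H → E H → F H ⊎ G H) → mass E? O ≤ mass F? O + mass G? O
    mass-subadditive E? F? G? []      _           E⊆F∪G = ≤-refl
    mass-subadditive E? F? G? ((H , w) ∷ O) (0≤o ∷ 0≤O) E⊆F∪G
      with E? H | F? H | G? H | mass-subadditive E? F? G? O 0≤O E⊆F∪G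
    ... | yes _ | yes _ | yes _ | ih = ≤-trans (+-monoʳ-≤ w ih)
          (≤-trans (≤-reflexive (sym (+-assoc w _ _))) (+-monoʳ-≤ (w + mass F? O) (x≤y+x 0≤o)))
    ... | yes _ | yes _ | no  _ | ih = ≤-trans (+-monoʳ-≤ w ih) (≤-reflexive (sym (+-assoc w _ _)))
    ... | yes _ | no  _ | yes _ | ih = ≤-trans (+-monoʳ-≤ w ih)
          (≤-reflexive (solve 3 (λ w a b → w :+ (a :+ b) := a :+ (w :+ b)) refl w (mass F? O) (mass G? O)))
    ... | yes e | no ¬f | no ¬g | _  with E⊆F∪G _ e
    ...   | inj₁ f = contradiction f ¬f
    ...   | inj₂ g = contradiction g ¬g
    mass-subadditive E? F? G? ((H , w) ∷ O) (0≤o ∷ 0≤O) E⊆F∪G | no _ | yes _ | yes _ | ih =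
      ≤-trans ih (+-mono-≤ (x≤y+x 0≤o) (x≤y+x 0≤o))
    mass-subadditive E? F? G? ((H , w) ∷ O) (0≤o ∷ 0≤O) E⊆F∪G | no _ | yes _ | no  _ | ih =
      ≤-trans ih (+-monoˡ-≤ (mass G? O) (x≤y+x 0≤o))
    mass-subadditive E? F? G? ((H , w) ∷ O) (0≤o ∷ 0≤O) E⊆F∪G | no _ | no  _ | yes _ | ih =
      ≤-trans ih (+-monoʳ-≤ (mass F? O) (x≤y+x 0≤o))
    mass-subadditive E? F? G? ((H , w) ∷ O) (0≤o ∷ 0≤O) E⊆F∪G | no _ | no  _ | no  _ | ih = ih

    mass-¬+mass≡total : ∀ {E : Event} (E? : Decidable E) O → mass (λ H → ¬? (E? H)) O + mass E? O ≡ total O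
    mass-¬+mass≡total E? []      = refl
    mass-¬+mass≡total E? (o ∷ O) with E? (proj₁ o)
    ... | yes _ = trans (solve 3 (λ a w b → a :+ (w :+ b) := w :+ (a :+ b)) refl
                          (mass (λ H → ¬? (E? H)) O) (proj₂ o) (mass E? O))
                        (cong (proj₂ o +_) (mass-¬+mass≡total E? O))
    ... | no  _ = trans (+-assoc (proj₂ o) _ _) (cong (proj₂ o +_) (mass-¬+mass≡total E? O))

    mass-any≤sum : ∀ {A : Set} {E : A → Event} (E? : ∀ a → Decidable (E a)) as O → NonNegWeights O →
                   mass (λ H → any? (λ a → E? a H) as) O ≤ sumℚ (map (λ a → mass (E? a) O) as)
    mass-any≤sum E? []       O 0≤O = ≤-reflexive (mass-∅ (λ H → any? (λ a → E? a H) []) O (λ _ ()))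
    mass-any≤sum E? (a ∷ as) O 0≤O = ≤-trans
      (mass-subadditive (λ H → any? (λ a → E? a H) (a ∷ as)) (E? a) (λ H → any? (λ a → E? a H) as) O 0≤O
        (λ { _ (here e) → inj₁ e ; _ (there e) → inj₂ e }))
      (+-monoʳ-≤ (mass (E? a) O) (mass-any≤sum E? as O 0≤O))

    branch : Subset n → ℚ → Hypergraph n × ℚ → Outcomes
    branch e p (H , w) = (e ∷ H , p * w) ∷ (H , (1ℚ - p) * w) ∷ []

    mass-branch : ∀ {E : Event} (E? : Decidable E) e p O →
      mass E? (concatMap (branch e p) O) ≡ p * mass (λ H → E? (e ∷ H)) O + (1ℚ - p) * mass E? O
    mass-branch E? e p [] = solve 1 (λ p → con 0ℚ := p :* con 0ℚ :+ (con 1ℚ :- p) :* con 0ℚ) refl p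
    mass-branch {E} E? e p ((H , w) ∷ O) = cases (E? (e ∷ H)) (E? H)
      where
      yes₁ no₁ : Hypergraph n × ℚ
      yes₁ = (e ∷ H , p * w)
      no₁  = (H , (1ℚ - p) * w)
      rest : Outcomes
      rest = concatMap (branch e p) O
      A B : ℚ
      A = mass (λ H → E? (e ∷ H)) O
      B = mass E? O
      ih : mass E? rest ≡ p * A + (1ℚ - p) * B
      ih = mass-branch E? e p O
      cases : Dec (E (e ∷ H)) → Dec (E H) →
              mass E? (yes₁ ∷ no₁ ∷ rest) ≡ p * mass (λ H → E? (e ∷ H)) ((H , w) ∷ O) + (1ℚ - p) * mass E? ((H , w) ∷ O)
      cases (yes a) (yes b)
        rewrite mass-∷-yes E? yes₁ (no₁ ∷ rest) a | mass-∷-yes E? no₁ rest b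
              | mass-∷-yes (λ H → E? (e ∷ H)) (H , w) O a | mass-∷-yes E? (H , w) O b | ih =
        solve 4 (λ p w a b → p :* w :+ ((con 1ℚ :- p) :* w :+ (p :* a :+ (con 1ℚ :- p) :* b))
                          := p :* (w :+ a) :+ (con 1ℚ :- p) :* (w :+ b)) refl p w A B
      cases (yes a) (no b)
        rewrite mass-∷-yes E? yes₁ (no₁ ∷ rest) a | mass-∷-no E? no₁ rest b
              | mass-∷-yes (λ H → E? (e ∷ H)) (H , w) O a | mass-∷-no E? (H , w) O b | ih =
        solve 4 (λ p w a b → p :* w :+ (p :* a :+ (con 1ℚ :- p) :* b)
                          := p :* (w :+ a) :+ (con 1ℚ :- p) :* b) refl p w A B
      cases (no a) (yes b)
        rewrite mass-∷-no E? yes₁ (no₁ ∷ rest) a | mass-∷-yes E? no₁ rest b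
              | mass-∷-no (λ H → E? (e ∷ H)) (H , w) O a | mass-∷-yes E? (H , w) O b | ih =
        solve 4 (λ p w a b → (con 1ℚ :- p) :* w :+ (p :* a :+ (con 1ℚ :- p) :* b)
                          := p :* a :+ (con 1ℚ :- p) :* (w :+ b)) refl p w A B
      cases (no a) (no b)
        rewrite mass-∷-no E? yes₁ (no₁ ∷ rest) a | mass-∷-no E? no₁ rest b
              | mass-∷-no (λ H → E? (e ∷ H)) (H , w) O a | mass-∷-no E? (H , w) O b = ih

    mass-outcomes-∷ : ∀ {E : Event} (E? : Decidable E) p e L → mass E? (outcomes p (e ∷ L))
                      ≡ p * mass (λ H → E? (e ∷ H)) (outcomes p L) + (1ℚ - p) * mass E? (outcomes p L)
    mass-outcomes-∷ E? p e L = mass-branch E? e p (outcomes p L)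

    outcomes-nonNeg : ∀ {p} L → 0ℚ ≤ p → p ≤ 1ℚ → NonNegWeights (outcomes p L)
    outcomes-nonNeg         []      0≤p p≤1 = 0≤1 ∷ []
    outcomes-nonNeg {p} (e ∷ L) 0≤p p≤1 = branch-nonNeg (outcomes p L) (outcomes-nonNeg L 0≤p p≤1)
      where
      branch-nonNeg : ∀ O → NonNegWeights O → NonNegWeights (concatMap (branch e p) O)
      branch-nonNeg []      _           = []
      branch-nonNeg (o ∷ O) (0≤o ∷ 0≤O) = 0≤* 0≤p 0≤o ∷ 0≤* (0≤1-p p≤1) 0≤o ∷ branch-nonNeg O 0≤O

    outcomes-total : ∀ p L → total (outcomes p L) ≡ 1ℚ
    outcomes-total p []      = refl
    outcomes-total p (e ∷ L) = begin
      total (outcomes p (e ∷ L))                                         ≡⟨ mass-outcomes-∷ (λ _ → yes tt) p e L ⟩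
      p * total (outcomes p L) + (1ℚ - p) * total (outcomes p L)         ≡⟨ cong (λ t → p * t + (1ℚ - p) * t) (outcomes-total p L) ⟩
      p * 1ℚ + (1ℚ - p) * 1ℚ                                             ≡⟨ solve 1 (λ p → p :* con 1ℚ :+ (con 1ℚ :- p) :* con 1ℚ := con 1ℚ) refl p ⟩
      1ℚ                                                                 ∎
      where open ≡-Reasoning

module EdgeEstimate where
  open import Data.Nat as ℕ using (ℕ; zero; suc; _≡ᵇ_; _≤ᵇ_)
  import Data.Nat.Properties as ℕ
  open import Data.Nat.Combinatorics using (_C_) renaming (nCk+nC[k+1]≡[n+1]C[k+1] to pascal)
  open import Data.Rational hiding (∣_∣; _≤ᵇ_)
  open import Data.Rational.Properties
  open import Data.Rational.Solver using (module +-*-Solver)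
  open import Data.Bool using (Bool)
  open import Data.List using (List; []; _∷_)
  open import Data.List.Relation.Unary.All using (All; []; _∷_; all?)
  open import Data.Product using (_×_; _,_)
  open import Relation.Nullary using (¬_; ¬?; _×-dec_)
  open import Relation.Unary using (Decidable)
  open import Relation.Binary.PropositionalEquality
  open import Data.Fin.Subset using (Subset; ∣_∣; _∩_)
  open import Defs using (ℕtoℚ; Hypergraph; outcomes)
  open Embedding
  open Power
  open Counting using (countᵇ; countᵇ-∷-true; countᵇ-∷-false)
  open Distribution
  open +-*-Solver

  module _ {n : ℕ} (W : Subset n) where

    meetsOnce : Subset n → Bool
    meetsOnce e = ∣ e ∩ W ∣ ≡ᵇ 1

    meetsTwice : Subset n → Bool
    meetsTwice e = 2 ≤ᵇ ∣ e ∩ W ∣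

    NoOnceManyTwice : ℕ → Hypergraph n → Set
    NoOnceManyTwice w H = All (λ e → ∣ e ∩ W ∣ ≢ 1) H × w ℕ.≤ countᵇ meetsTwice H

    noOnceManyTwice? : ∀ w → Decidable (NoOnceManyTwice w)
    noOnceManyTwice? w H = all? (λ e → ¬? (∣ e ∩ W ∣ ℕ.≟ 1)) H ×-dec (w ℕ.≤? countᵇ meetsTwice H)

    module _ {p : ℚ} (0≤p : 0ℚ ≤ p) (p≤1 : p ≤ 1ℚ) where

      q : ℚ
      q = 1ℚ - p

      0≤q : 0ℚ ≤ q
      0≤q = 0≤1-p p≤1

      bound : ℕ → ℕ → ℕ → ℚ
      bound a m w = q ^ a * (ℕtoℚ (m C w) * p ^ w)

      average-≤ : ∀ {x y} → y ≤ x → 0ℚ ≤ y → p * y + q * x ≤ x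
      average-≤ {x} y≤x 0≤y = ≤-trans (+-monoˡ-≤ (q * x) (*-monoˡ-≤-0≤ 0≤p y≤x))
        (≤-reflexive (solve 2 (λ p x → p :* x :+ (con 1ℚ :- p) :* x := x) refl p x))

      drop-disjoint : ∀ {e H w} → ∣ e ∩ W ∣ ≡ 0 → NoOnceManyTwice w (e ∷ H) → NoOnceManyTwice w H
      drop-disjoint eq (_ ∷ ok , w≤) rewrite eq = ok , w≤

      drop-twice : ∀ {e H w c} → ∣ e ∩ W ∣ ≡ suc (suc c) → NoOnceManyTwice (suc w) (e ∷ H) → NoOnceManyTwice w H
      drop-twice eq (_ ∷ ok , 1+w≤) rewrite eq = ok , ℕ.≤-pred 1+w≤

      drop-twice₀ : ∀ {e H} → NoOnceManyTwice 0 (e ∷ H) → NoOnceManyTwice 0 H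
      drop-twice₀ (_ ∷ ok , _) = ok , ℕ.z≤n

      not-once : ∀ {e H w} → ∣ e ∩ W ∣ ≡ 1 → ¬ NoOnceManyTwice w (e ∷ H)
      not-once eq (≢1 ∷ _ , _) = ≢1 eq

      private
        mass-E : ℕ → List (Subset n) → ℚ
        mass-E w L = mass (noOnceManyTwice? w) (outcomes p L)

        mass-E-after : Subset n → ℕ → List (Subset n) → ℚ
        mass-E-after e w L = mass (λ H → noOnceManyTwice? w (e ∷ H)) (outcomes p L)

        0≤mass-E-after : ∀ e w L → 0ℚ ≤ mass-E-after e w L
        0≤mass-E-after e w L = mass-nonNeg (λ H → noOnceManyTwice? w (e ∷ H)) (outcomes p L) (outcomes-nonNeg L 0≤p p≤1)

        mass-E-after-mono : ∀ {e v w} L → (∀ {H} → NoOnceManyTwice w (e ∷ H) → NoOnceManyTwice v H) →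
                            mass-E-after e w L ≤ mass-E v L
        mass-E-after-mono {e} {v} {w} L step =
          mass-mono (λ H → noOnceManyTwice? w (e ∷ H)) (noOnceManyTwice? v) (outcomes p L) (outcomes-nonNeg L 0≤p p≤1)
                    (λ _ → step)

        pascal-step : ∀ Q c₁ c₂ P → 0ℚ ≤ Q → 0ℚ ≤ P →
                      p * (Q * (ℕtoℚ c₁ * P)) + q * (Q * (ℕtoℚ c₂ * (p * P))) ≤ Q * (ℕtoℚ (c₁ ℕ.+ c₂) * (p * P))
        pascal-step Q c₁ c₂ P 0≤Q 0≤P = begin
          p * (Q * (ℕtoℚ c₁ * P)) + q * (Q * (ℕtoℚ c₂ * (p * P)))
            ≤⟨ +-monoʳ-≤ (p * (Q * (ℕtoℚ c₁ * P))) (≤-trans (*-monoʳ-≤-0≤ 0≤rest (1-p≤1 0≤p)) (≤-reflexive (*-identityˡ _))) ⟩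
          p * (Q * (ℕtoℚ c₁ * P)) + Q * (ℕtoℚ c₂ * (p * P))
            ≡⟨ solve 5 (λ p Q a b P → p :* (Q :* (a :* P)) :+ Q :* (b :* (p :* P)) := Q :* ((a :+ b) :* (p :* P)))
                       refl p Q (ℕtoℚ c₁) (ℕtoℚ c₂) P ⟩
          Q * ((ℕtoℚ c₁ + ℕtoℚ c₂) * (p * P))
            ≡⟨ cong (λ c → Q * (c * (p * P))) (ℕtoℚ-+ c₁ c₂) ⟨
          Q * (ℕtoℚ (c₁ ℕ.+ c₂) * (p * P)) ∎
          where
          open ≤-Reasoning
          0≤rest : 0ℚ ≤ Q * (ℕtoℚ c₂ * (p * P))
          0≤rest = 0≤* 0≤Q (0≤* (ℕtoℚ-nonNeg c₂) (0≤* 0≤p 0≤P))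

        module Step (e : Subset n) (L : List (Subset n))
                    (ih : ∀ w → mass-E w L ≤ bound (countᵇ meetsOnce L) (countᵇ meetsTwice L) w) where

          a m : ℕ
          a = countᵇ meetsOnce L
          m = countᵇ meetsTwice L

          step-disjoint : ∣ e ∩ W ∣ ≡ 0 → ∀ w → mass-E w (e ∷ L) ≤ bound (countᵇ meetsOnce (e ∷ L)) (countᵇ meetsTwice (e ∷ L)) w
          step-disjoint eq w = begin
            mass-E w (e ∷ L)                         ≡⟨ mass-outcomes-∷ (noOnceManyTwice? w) p e L ⟩
            p * mass-E-after e w L + q * mass-E w L  ≤⟨ average-≤ (mass-E-after-mono L (drop-disjoint eq)) (0≤mass-E-after e w L) ⟩
            mass-E w L                               ≤⟨ ih w ⟩
            bound a m w                              ≡⟨ cong₂ (λ a m → bound a m w) (countᵇ-∷-false {f = meetsOnce} {e} L (cong (_≡ᵇ 1) eq))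
                                                                                    (countᵇ-∷-false {f = meetsTwice} {e} L (cong (2 ≤ᵇ_) eq)) ⟨
            bound (countᵇ meetsOnce (e ∷ L)) (countᵇ meetsTwice (e ∷ L)) w ∎
            where open ≤-Reasoning

          step-once : ∣ e ∩ W ∣ ≡ 1 → ∀ w → mass-E w (e ∷ L) ≤ bound (countᵇ meetsOnce (e ∷ L)) (countᵇ meetsTwice (e ∷ L)) w
          step-once eq w = begin
            mass-E w (e ∷ L)                         ≡⟨ mass-outcomes-∷ (noOnceManyTwice? w) p e L ⟩
            p * mass-E-after e w L + q * mass-E w L  ≡⟨ cong (λ x → p * x + q * mass-E w L)
                                                        (mass-∅ (λ H → noOnceManyTwice? w (e ∷ H)) (outcomes p L) (λ _ → not-once eq)) ⟩
            p * 0ℚ + q * mass-E w L                  ≡⟨ trans (cong (_+ q * mass-E w L) (*-zeroʳ p)) (+-identityˡ (q * mass-E w L)) ⟩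
            q * mass-E w L                           ≤⟨ *-monoˡ-≤-0≤ 0≤q (ih w) ⟩
            q * bound a m w                          ≡⟨ *-assoc q (q ^ a) (ℕtoℚ (m C w) * p ^ w) ⟨
            bound (suc a) m w                        ≡⟨ cong₂ (λ a m → bound a m w) (countᵇ-∷-true {f = meetsOnce} {e} L (cong (_≡ᵇ 1) eq))
                                                                                    (countᵇ-∷-false {f = meetsTwice} {e} L (cong (2 ≤ᵇ_) eq)) ⟨
            bound (countᵇ meetsOnce (e ∷ L)) (countᵇ meetsTwice (e ∷ L)) w ∎
            where open ≤-Reasoning

          step-twice : ∀ {c} → ∣ e ∩ W ∣ ≡ suc (suc c) → ∀ w →
                       mass-E w (e ∷ L) ≤ bound (countᵇ meetsOnce (e ∷ L)) (countᵇ meetsTwice (e ∷ L)) w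
          step-twice eq w = begin
            mass-E w (e ∷ L)                         ≡⟨ mass-outcomes-∷ (noOnceManyTwice? w) p e L ⟩
            p * mass-E-after e w L + q * mass-E w L  ≤⟨ branches w ⟩
            bound a (suc m) w                        ≡⟨ cong₂ (λ a m → bound a m w) (countᵇ-∷-false {f = meetsOnce} {e} L (cong (_≡ᵇ 1) eq))
                                                                                    (countᵇ-∷-true {f = meetsTwice} {e} L (cong (2 ≤ᵇ_) eq)) ⟨
            bound (countᵇ meetsOnce (e ∷ L)) (countᵇ meetsTwice (e ∷ L)) w ∎
            where
            open ≤-Reasoning
            branches : ∀ w → p * mass-E-after e w L + q * mass-E w L ≤ bound a (suc m) w
            branches zero    = ≤-trans (average-≤ (mass-E-after-mono L drop-twice₀) (0≤mass-E-after e 0 L)) (ih 0)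
            branches (suc v) = begin
              p * mass-E-after e (suc v) L + q * mass-E (suc v) L
                ≤⟨ +-mono-≤ (*-monoˡ-≤-0≤ 0≤p (≤-trans (mass-E-after-mono L (drop-twice eq)) (ih v)))
                            (*-monoˡ-≤-0≤ 0≤q (ih (suc v))) ⟩
              p * bound a m v + q * bound a m (suc v)
                ≤⟨ pascal-step (q ^ a) (m C v) (m C suc v) (p ^ v) (^-nonNeg a 0≤q) (^-nonNeg v 0≤p) ⟩
              q ^ a * (ℕtoℚ ((m C v) ℕ.+ (m C suc v)) * p ^ suc v)
                ≡⟨ cong (λ c → q ^ a * (ℕtoℚ c * p ^ suc v)) (pascal m v) ⟩
              bound a (suc m) (suc v) ∎

      mass-noOnceManyTwice≤ : ∀ L w → mass (noOnceManyTwice? w) (outcomes p L)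
                                      ≤ bound (countᵇ meetsOnce L) (countᵇ meetsTwice L) w
      mass-noOnceManyTwice≤ [] zero    = ≤-reflexive (mass-∷-yes (noOnceManyTwice? 0) ([] , 1ℚ) [] ([] , ℕ.z≤n))
      mass-noOnceManyTwice≤ [] (suc w) = ≤-trans (≤-reflexive (mass-∷-no (noOnceManyTwice? (suc w)) ([] , 1ℚ) [] λ ()))
        (0≤* 0≤1 (0≤* (ℕtoℚ-nonNeg (0 C suc w)) (^-nonNeg (suc w) 0≤p)))
      mass-noOnceManyTwice≤ (e ∷ L) w = by-meeting ∣ e ∩ W ∣ refl w
        where
        open Step e L (mass-noOnceManyTwice≤ L)
        by-meeting : ∀ c → ∣ e ∩ W ∣ ≡ c → ∀ w →
                     mass-E w (e ∷ L) ≤ bound (countᵇ meetsOnce (e ∷ L)) (countᵇ meetsTwice (e ∷ L)) w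
        by-meeting zero          = step-disjoint
        by-meeting (suc zero)    = step-once
        by-meeting (suc (suc _)) = step-twice

module Sums where
  open import Data.Nat as ℕ using (ℕ; zero; suc)
  import Data.Nat.Properties as ℕ
  open import Data.Nat.Combinatorics using (_C_; k>n⇒nCk≡0) renaming (nCk+nC[k+1]≡[n+1]C[k+1] to pascal)
  open import Data.Rational hiding (∣_∣)
  open import Data.Rational.Properties
  open import Data.Rational.Solver using (module +-*-Solver)
  open import Data.List using (List; []; _∷_; _++_; map)
  import Data.List.Properties as List
  open import Data.Vec using ([]; _∷_)
  open import Data.Bool using (true; false)
  open import Data.Fin.Subset using (Subset; ∣_∣)
  open import Relation.Binary.PropositionalEquality
  open import Defs using (ℕtoℚ; subsets; sumℚ)
  open Embedding
  open Power
  open +-*-Solver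

  sumℚ-++ : ∀ xs ys → sumℚ (xs ++ ys) ≡ sumℚ xs + sumℚ ys
  sumℚ-++ []       ys = sym (+-identityˡ (sumℚ ys))
  sumℚ-++ (x ∷ xs) ys = trans (cong (x +_) (sumℚ-++ xs ys)) (sym (+-assoc x (sumℚ xs) (sumℚ ys)))

  sumℚ-mono : ∀ {A : Set} {f g : A → ℚ} xs → (∀ x → f x ≤ g x) → sumℚ (map f xs) ≤ sumℚ (map g xs)
  sumℚ-mono []       f≤g = ≤-refl
  sumℚ-mono (x ∷ xs) f≤g = +-mono-≤ (f≤g x) (sumℚ-mono xs f≤g)

  sumTo : ℕ → (ℕ → ℚ) → ℚ
  sumTo zero    f = 0ℚ
  sumTo (suc m) f = f 0 + sumTo m (λ w → f (suc w))

  sumTo-cong : ∀ m {f g : ℕ → ℚ} → (∀ w → f w ≡ g w) → sumTo m f ≡ sumTo m g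
  sumTo-cong zero    f≗g = refl
  sumTo-cong (suc m) f≗g = cong₂ _+_ (f≗g 0) (sumTo-cong m (λ w → f≗g (suc w)))

  sumTo-mono : ∀ m {f g : ℕ → ℚ} → (∀ w → f w ≤ g w) → sumTo m f ≤ sumTo m g
  sumTo-mono zero    f≤g = ≤-refl
  sumTo-mono (suc m) f≤g = +-mono-≤ (f≤g 0) (sumTo-mono m (λ w → f≤g (suc w)))

  sumTo-+ : ∀ m (f g : ℕ → ℚ) → sumTo m (λ w → f w + g w) ≡ sumTo m f + sumTo m g
  sumTo-+ zero    f g = refl
  sumTo-+ (suc m) f g rewrite sumTo-+ m (λ w → f (suc w)) (λ w → g (suc w)) =
    solve 4 (λ a b c d → (a :+ b) :+ (c :+ d) := (a :+ c) :+ (b :+ d)) refl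
      (f 0) (g 0) (sumTo m (λ w → f (suc w))) (sumTo m (λ w → g (suc w)))

  sumTo-*ˡ : ∀ m y (f : ℕ → ℚ) → sumTo m (λ w → y * f w) ≡ y * sumTo m f
  sumTo-*ˡ zero    y f = sym (*-zeroʳ y)
  sumTo-*ˡ (suc m) y f rewrite sumTo-*ˡ m y (λ w → f (suc w)) = sym (*-distribˡ-+ y (f 0) _)

  sumTo-last : ∀ m (f : ℕ → ℚ) → sumTo (suc m) f ≡ sumTo m f + f m
  sumTo-last zero    f = trans (+-identityʳ (f 0)) (sym (+-identityˡ (f 0)))
  sumTo-last (suc m) f rewrite sumTo-last m (λ w → f (suc w)) = sym (+-assoc (f 0) _ (f (suc m)))

  sumTo-pascal : ∀ n (f : ℕ → ℚ) → sumTo (suc (suc n)) (λ w → ℕtoℚ (suc n C w) * f w)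
                       ≡ sumTo (suc n) (λ w → ℕtoℚ (n C w) * f (suc w)) + sumTo (suc n) (λ w → ℕtoℚ (n C w) * f w)
  sumTo-pascal n f = begin
    1ℚ * f 0 + sumTo (suc n) (λ w → ℕtoℚ (suc n C suc w) * f (suc w))
      ≡⟨ cong₂ _+_ (*-identityˡ (f 0)) (sumTo-cong (suc n) split) ⟩
    f 0 + sumTo (suc n) (λ w → ℕtoℚ (n C w) * f (suc w) + ℕtoℚ (n C suc w) * f (suc w))
      ≡⟨ cong (f 0 +_) (sumTo-+ (suc n) (λ w → ℕtoℚ (n C w) * f (suc w)) (λ w → ℕtoℚ (n C suc w) * f (suc w))) ⟩
    f 0 + (A + sumTo (suc n) (λ w → ℕtoℚ (n C suc w) * f (suc w)))
      ≡⟨ cong (λ z → f 0 + (A + z)) (trans (sumTo-last n (λ w → ℕtoℚ (n C suc w) * f (suc w))) (trans (cong (λ c → B + ℕtoℚ c * f (suc n)) top-vanishes)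
                                                                 (trans (cong (B +_) (*-zeroˡ (f (suc n)))) (+-identityʳ B)))) ⟩
    f 0 + (A + B)
      ≡⟨ solve 3 (λ f a b → f :+ (a :+ b) := a :+ (f :+ b)) refl (f 0) A B ⟩
    A + (f 0 + B)
      ≡⟨ cong (λ z → A + (z + B)) (*-identityˡ (f 0)) ⟨
    A + sumTo (suc n) (λ w → ℕtoℚ (n C w) * f w) ∎
    where
    open ≡-Reasoning
    A B : ℚ
    A = sumTo (suc n) (λ w → ℕtoℚ (n C w) * f (suc w))
    B = sumTo n (λ w → ℕtoℚ (n C suc w) * f (suc w))
    split : ∀ w → ℕtoℚ (suc n C suc w) * f (suc w) ≡ ℕtoℚ (n C w) * f (suc w) + ℕtoℚ (n C suc w) * f (suc w)
    split w = trans (cong (λ c → ℕtoℚ c * f (suc w)) (sym (pascal n w)))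
                    (trans (cong (_* f (suc w)) (ℕtoℚ-+ (n C w) (n C suc w))) (*-distribʳ-+ (f (suc w)) (ℕtoℚ (n C w)) (ℕtoℚ (n C suc w))))
    top-vanishes : (n C suc n) ≡ 0
    top-vanishes = k>n⇒nCk≡0 (ℕ.n<1+n n)

  sum-subsets-by-size : ∀ n (f : ℕ → ℚ) →
    sumℚ (map (λ W → f ∣ W ∣) (subsets n)) ≡ sumTo (suc n) (λ w → ℕtoℚ (n C w) * f w)
  sum-subsets-by-size zero    f = cong (_+ 0ℚ) (sym (*-identityˡ (f 0)))
  sum-subsets-by-size (suc n) f = begin
    sumℚ (map g (map (true ∷_) (subsets n) ++ map (false ∷_) (subsets n)))
      ≡⟨ cong sumℚ (List.map-++ g (map (true ∷_) (subsets n)) (map (false ∷_) (subsets n))) ⟩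
    sumℚ (map g (map (true ∷_) (subsets n)) ++ map g (map (false ∷_) (subsets n)))
      ≡⟨ sumℚ-++ (map g (map (true ∷_) (subsets n))) (map g (map (false ∷_) (subsets n))) ⟩
    sumℚ (map g (map (true ∷_) (subsets n))) + sumℚ (map g (map (false ∷_) (subsets n)))
      ≡⟨ cong₂ (λ xs ys → sumℚ xs + sumℚ ys) (List.map-∘ {g = g} {f = true ∷_} (subsets n)) (List.map-∘ {g = g} {f = false ∷_} (subsets n)) ⟨
    sumℚ (map (λ W → f (suc ∣ W ∣)) (subsets n)) + sumℚ (map (λ W → f ∣ W ∣) (subsets n))
      ≡⟨ cong₂ _+_ (sum-subsets-by-size n (λ w → f (suc w))) (sum-subsets-by-size n f) ⟩
    sumTo (suc n) (λ w → ℕtoℚ (n C w) * f (suc w)) + sumTo (suc n) (λ w → ℕtoℚ (n C w) * f w)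
      ≡⟨ sumTo-pascal n f ⟨
    sumTo (suc (suc n)) (λ w → ℕtoℚ (suc n C w) * f w) ∎
    where
    open ≡-Reasoning
    g : Subset (suc n) → ℚ
    g W = f ∣ W ∣

  geometric-≤ : ∀ m {y} → 0ℚ ≤ y → y + y ≤ 1ℚ → sumTo m (λ w → y ^ suc w) ≤ y + y
  geometric-≤ zero    0≤y 2y≤1 = 0≤+ 0≤y 0≤y
  geometric-≤ (suc m) {y} 0≤y 2y≤1 = begin
    y * 1ℚ + sumTo m (λ w → y * y ^ suc w) ≡⟨ cong₂ _+_ (*-identityʳ y) (sumTo-*ˡ m y (λ w → y ^ suc w)) ⟩
    y + y * sumTo m (λ w → y ^ suc w)      ≤⟨ +-monoʳ-≤ y (*-monoˡ-≤-0≤ 0≤y (≤-trans (geometric-≤ m 0≤y 2y≤1) 2y≤1)) ⟩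
    y + y * 1ℚ                             ≡⟨ cong (y +_) (*-identityʳ y) ⟩
    y + y                                  ∎
    where open ≤-Reasoning

module BadSets where
  open import Data.Nat as ℕ using (ℕ; zero; suc; _∸_; _^_)
  import Data.Nat.Properties as ℕ
  open import Data.Nat.Combinatorics using (_C_)
  open import Data.Rational using (ℚ; 0ℚ; 1ℚ; _≤_; _*_; _-_)
  open import Data.Rational.Properties using (_≤?_)
  import Data.Rational.Properties
  open import Data.List using (List; []; _∷_)
  open import Data.List.Relation.Unary.All using (All; []; _∷_; all?)
  open import Data.Product using (_×_; _,_)
  open import Relation.Nullary using (¬?; _×-dec_; contradiction)
  open import Relation.Unary using (Decidable)
  open import Relation.Binary.PropositionalEquality
  open import Data.Fin.Subset using (Subset; ∣_∣; _∩_; Nonempty; _∈_)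
  open import Data.Fin.Subset.Properties using (nonempty?; ∣⁅x⁆∣≡1; p⊆q⇒∣p∣≤∣q∣; x∈⁅y⁆⇒x≡y; ∣∁p∣≡n∸∣p∣)
  open import Defs
  open Embedding using (*-monoˡ-≤-0≤; *-monoʳ-≤-0≤; 0≤1-p; ℕtoℚ-mono)
  open Power using (^-nonNeg) renaming (_^_ to _^ℚ_)
  open Binomial using (C-monoˡ-≤)
  open Counting using (countᵇ; countᵇ-kSubsets; count-meetsOnce; count-meets≥)
  open Distribution using (mass; mass-mono; outcomes-nonNeg)
  open EdgeEstimate using (meetsOnce; meetsTwice; NoOnceManyTwice; noOnceManyTwice?; mass-noOnceManyTwice≤)

  Nonempty⇒1≤∣p∣ : ∀ {n} {p : Subset n} → Nonempty p → 1 ℕ.≤ ∣ p ∣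
  Nonempty⇒1≤∣p∣ {p = p} (x , x∈p) = subst (ℕ._≤ ∣ p ∣) (∣⁅x⁆∣≡1 x)
    (p⊆q⇒∣p∣≤∣q∣ λ y∈⁅x⁆ → subst (_∈ p) (sym (x∈⁅y⁆⇒x≡y x y∈⁅x⁆)) x∈p)

  module _ {n : ℕ} (δ : ℚ) (W : Subset n) where

    badSet? : Decidable (λ H → BadSet δ H W)
    badSet? H = nonempty? W
      ×-dec (ℕtoℚ ∣ W ∣ ≤? δ * ℕtoℚ n)
      ×-dec all? (λ e → ¬? (∣ e ∩ W ∣ ℕ.≟ 1)) H
      ×-dec (∣ W ∣ ℕ.≤? edgesMeeting H W)

    edgesMeeting≤meetsTwice : ∀ H → All (λ e → ∣ e ∩ W ∣ ≢ 1) H → edgesMeeting H W ℕ.≤ countᵇ (meetsTwice W) H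
    edgesMeeting≤meetsTwice []      _          = ℕ.z≤n
    edgesMeeting≤meetsTwice (e ∷ H) (≢1 ∷ ok) with ∣ e ∩ W ∣ in eq
    ... | zero        = edgesMeeting≤meetsTwice H ok
    ... | suc zero    = contradiction refl ≢1
    ... | suc (suc _) = ℕ.s≤s (edgesMeeting≤meetsTwice H ok)

    badSet⇒noOnceManyTwice : ∀ {H} → BadSet δ H W → NoOnceManyTwice W ∣ W ∣ H
    badSet⇒noOnceManyTwice {H} (_ , _ , ok , w≤) = ok , ℕ.≤-trans w≤ (edgesMeeting≤meetsTwice H ok)

    badSet⇒size : ∀ {H} → BadSet δ H W → 1 ℕ.≤ ∣ W ∣ × ℕtoℚ ∣ W ∣ ≤ δ * ℕtoℚ n
    badSet⇒size (nonempty , small , _) = Nonempty⇒1≤∣p∣ nonempty , small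

  badSetBound : ℕ → ℕ → ℚ → ℕ → ℚ
  badSetBound n j p w = (1ℚ - p) ^ℚ (w ℕ.* ((n ∸ w) C j)) * (ℕtoℚ ((w ^ 2 ℕ.* n ^ (j ∸ 1)) C w) * p ^ℚ w)

  module _ {n : ℕ} (δ : ℚ) (j : ℕ) {p : ℚ} (0≤p : 0ℚ ≤ p) (p≤1 : p ≤ 1ℚ) where

    mass-badSet≤ : 1 ℕ.≤ j → ∀ W → mass (badSet? δ W) (outcomes p (kSubsets n (suc j))) ≤ badSetBound n j p ∣ W ∣
    mass-badSet≤ 1≤j W = begin
      mass (badSet? δ W) (outcomes p E)
        ≤⟨ mass-mono (badSet? δ W) (noOnceManyTwice? W w) (outcomes p E) (outcomes-nonNeg E 0≤p p≤1)
                     (λ _ → badSet⇒noOnceManyTwice δ W) ⟩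
      mass (noOnceManyTwice? W w) (outcomes p E)
        ≤⟨ mass-noOnceManyTwice≤ W 0≤p p≤1 E w ⟩
      (1ℚ - p) ^ℚ a * (ℕtoℚ (m C w) * p ^ℚ w)
        ≡⟨ cong (λ a → (1ℚ - p) ^ℚ a * (ℕtoℚ (m C w) * p ^ℚ w)) a≡w*[n∸w]Cj ⟩
      (1ℚ - p) ^ℚ (w ℕ.* ((n ∸ w) C j)) * (ℕtoℚ (m C w) * p ^ℚ w)
        ≤⟨ *-monoˡ-≤-0≤ (^-nonNeg (w ℕ.* ((n ∸ w) C j)) (0≤1-p p≤1)) (*-monoʳ-≤-0≤ (^-nonNeg w 0≤p) (ℕtoℚ-mono (C-monoˡ-≤ w m≤w²n^[j∸1]))) ⟩
      badSetBound n j p w ∎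
      where
      open Data.Rational.Properties.≤-Reasoning
      E : List (Subset n)
      E = kSubsets n (suc j)
      w a m : ℕ
      w = ∣ W ∣
      a = countᵇ (meetsOnce W) E
      m = countᵇ (meetsTwice W) E
      a≡w*[n∸w]Cj : a ≡ w ℕ.* ((n ∸ w) C j)
      a≡w*[n∸w]Cj = trans (countᵇ-kSubsets (suc j) (meetsOnce W))
        (trans (count-meetsOnce W j) (cong (λ c → w ℕ.* (c C j)) (∣∁p∣≡n∸∣p∣ W)))
      m≤w²n^[j∸1] : m ℕ.≤ w ^ 2 ℕ.* n ^ (j ∸ 1)
      m≤w²n^[j∸1] = ℕ.≤-trans (ℕ.≤-reflexive (countᵇ-kSubsets (suc j) (meetsTwice W))) (count-meets≥ W 2 (suc j) (ℕ.s≤s 1≤j))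

module Asymptotics where
  open import Data.Nat as ℕ using (ℕ; zero; suc; _∸_)
  import Data.Nat.Properties as ℕ
  import Data.Integer as ℤ
  import Data.Integer.Properties as ℤ
  import Data.Nat.Coprimality as Coprime
  open import Data.Rational hiding (∣_∣; _≤ᵇ_)
  open import Data.Rational.Properties
  open import Data.Rational.Solver using (module +-*-Solver)
  import Data.Rational.Unnormalised as ℚᵘ
  import Data.Rational.Unnormalised.Properties as ℚᵘ
  open import Data.Product using (_×_; _,_; ∃)
  open import Relation.Nullary using (yes; no; contradiction)
  open import Relation.Binary.PropositionalEquality
  open import Defs using (ℕtoℚ)
  open import Data.Nat.Combinatorics using (_C_)
  open Embedding
  open Power
  open Binomial using (n^j≤[2jr]^j*mCj; nCk*[k²n^i]Ck≤[64*n^[1+i]]^k)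
  open BadSets using (badSetBound)
  open +-*-Solver

  [1-p]^D*[pe]²≤κ² : ∀ {p} T D e κ → 0ℚ ≤ p → p ≤ 1ℚ → T ℕ.+ T ℕ.≤ D → e ℕ.≤ κ ℕ.* T →
                     (1ℚ - p) ^ D * ((p * ℕtoℚ e) * (p * ℕtoℚ e)) ≤ ℕtoℚ (κ ℕ.* κ)
  [1-p]^D*[pe]²≤κ² {p} T D e κ 0≤p p≤1 2T≤D e≤κT = begin
    (1ℚ - p) ^ D * ((p * ℕtoℚ e) * (p * ℕtoℚ e))
      ≤⟨ *-mono-≤-0≤ (0≤* 0≤Q 0≤Q) (0≤* 0≤pe 0≤pe)
           (≤-trans (^-antitoneʳ (0≤1-p p≤1) (1-p≤1 0≤p) 2T≤D) (≤-reflexive (^-homo-* (1ℚ - p) T T)))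
           (*-mono-≤-0≤ 0≤pκt 0≤pe pe≤pκt pe≤pκt) ⟩
    (Q * Q) * ((p * (k * t)) * (p * (k * t)))
      ≡⟨ solve 4 (λ Q p k t → (Q :* Q) :* ((p :* (k :* t)) :* (p :* (k :* t)))
                           := (k :* k) :* ((Q :* (t :* p)) :* (Q :* (t :* p)))) refl Q p k t ⟩
    (k * k) * ((Q * (t * p)) * (Q * (t * p)))
      ≤⟨ *-monoˡ-≤-0≤ (0≤* 0≤k 0≤k) (*-mono-≤-0≤ 0≤1 0≤Qtp Qtp≤1 Qtp≤1) ⟩
    (k * k) * (1ℚ * 1ℚ)
      ≡⟨ trans (*-identityʳ (k * k)) (sym (ℕtoℚ-* κ κ)) ⟩
    ℕtoℚ (κ ℕ.* κ) ∎
    where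
    open ≤-Reasoning
    Q t k : ℚ
    Q = (1ℚ - p) ^ T
    t = ℕtoℚ T
    k = ℕtoℚ κ
    0≤Q : 0ℚ ≤ Q
    0≤Q = ^-nonNeg T (0≤1-p p≤1)
    0≤k : 0ℚ ≤ k
    0≤k = ℕtoℚ-nonNeg κ
    0≤pe : 0ℚ ≤ p * ℕtoℚ e
    0≤pe = 0≤* 0≤p (ℕtoℚ-nonNeg e)
    0≤pκt : 0ℚ ≤ p * (k * t)
    0≤pκt = 0≤* 0≤p (0≤* 0≤k (ℕtoℚ-nonNeg T))
    pe≤pκt : p * ℕtoℚ e ≤ p * (k * t)
    pe≤pκt = *-monoˡ-≤-0≤ 0≤p (≤-trans (ℕtoℚ-mono e≤κT) (≤-reflexive (ℕtoℚ-* κ T)))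
    0≤Qtp : 0ℚ ≤ Q * (t * p)
    0≤Qtp = 0≤* 0≤Q (0≤* (ℕtoℚ-nonNeg T) 0≤p)
    Qtp≤1 : Q * (t * p) ≤ 1ℚ
    Qtp≤1 = ≤-trans (*-monoˡ-≤-0≤ 0≤Q (x≤y+x 0≤1)) (bernoulli T 0≤p p≤1)

  [1+b]*mkℚ[c,b]≡c : ∀ c b .(cop : Coprime.Coprime c (suc b)) → ℕtoℚ (suc b) * mkℚ (ℤ.+ c) b cop ≡ ℕtoℚ c
  [1+b]*mkℚ[c,b]≡c c b cop = toℚᵘ-injective (ℚᵘ.≃-trans (toℚᵘ-homo-* (ℕtoℚ (suc b)) (mkℚ (ℤ.+ c) b cop)) cross)
    where
    cross : toℚᵘ (ℕtoℚ (suc b)) ℚᵘ.* toℚᵘ (mkℚ (ℤ.+ c) b cop) ℚᵘ.≃ toℚᵘ (ℕtoℚ c)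
    cross rewrite ℕtoℚ≡mkℚ (suc b) | ℕtoℚ≡mkℚ c = ℚᵘ.*≡* (trans (trans (ℤ.*-identityʳ _) (ℤ.+◃n≡+n (c ℕ.+ b ℕ.* c)))
      (trans (cong ℤ.+_ c+b*c≡c*[1+b]) (ℤ.pos-* c (suc (b ℕ.+ 0)))))
      where
      c+b*c≡c*[1+b] : c ℕ.+ b ℕ.* c ≡ c ℕ.* suc (b ℕ.+ 0)
      c+b*c≡c*[1+b] rewrite ℕ.+-identityʳ b = trans (cong (c ℕ.+_) (ℕ.*-comm b c)) (sym (ℕ.*-suc c b))

  *-cancelˡ-≤-ℕtoℚ : ∀ b {x y} → ℕtoℚ (suc b) * x ≤ ℕtoℚ (suc b) * y → x ≤ y
  *-cancelˡ-≤-ℕtoℚ b = *-cancelˡ-≤-pos (ℕtoℚ (suc b)) {{positive (ℕtoℚ-pos b)}}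

  n≤[1+b]*[n∸w] : ∀ a b n w → suc b ℕ.* w ℕ.≤ a ℕ.* n → a ℕ.≤ b → n ℕ.≤ suc b ℕ.* (n ∸ w)
  n≤[1+b]*[n∸w] a b n w [1+b]w≤an a≤b with w ℕ.≤? n
  ... | no w≰n = contradiction [1+b]w≤an (ℕ.<⇒≱ an<[1+b]w)
    where
    an<[1+b]w : a ℕ.* n ℕ.< suc b ℕ.* w
    an<[1+b]w = ℕ.≤-<-trans (ℕ.*-monoˡ-≤ n a≤b)
      (ℕ.≤-<-trans (ℕ.*-monoʳ-≤ b (ℕ.<⇒≤ (ℕ.≰⇒> w≰n))) (ℕ.m<n+m (b ℕ.* w) (ℕ.≤-trans (ℕ.s≤s ℕ.z≤n) (ℕ.≰⇒> w≰n))))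
  ... | yes w≤n with ℕ.m≤n⇒∃[o]m+o≡n w≤n
  ...   | t , refl rewrite ℕ.m+n∸m≡n w t = ℕ.≤-trans (ℕ.+-monoˡ-≤ t w≤bt) (ℕ.≤-reflexive (ℕ.+-comm (b ℕ.* t) t))
    where
    w≤bt : w ℕ.≤ b ℕ.* t
    w≤bt = ℕ.+-cancelˡ-≤ (b ℕ.* w) w (b ℕ.* t) (ℕ.≤-trans (ℕ.≤-reflexive (ℕ.+-comm (b ℕ.* w) w))
      (ℕ.≤-trans [1+b]w≤an (ℕ.≤-trans (ℕ.*-monoˡ-≤ (w ℕ.+ t) a≤b) (ℕ.≤-reflexive (ℕ.*-distribˡ-+ b w t)))))

  linear-gap : ∀ {δ} → 0ℚ ≤ δ → δ < 1ℚ → ∃ λ r → ∀ {w n} → ℕtoℚ w ≤ δ * ℕtoℚ n → n ℕ.≤ suc r ℕ.* (n ∸ w)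
  linear-gap {mkℚ (ℤ.+ a) b cop} _ δ<1 = b , λ {w} {n} w≤δn → n≤[1+b]*[n∸w] a b n w ([1+b]w≤an w≤δn) a≤b
    where
    a≤b : a ℕ.≤ b
    a≤b = ℕ.≤-pred (ℕtoℚ-cancel-< (subst₂ _<_ ([1+b]*mkℚ[c,b]≡c a b cop) (*-identityʳ (ℕtoℚ (suc b)))
            (*-monoʳ-<-pos (ℕtoℚ (suc b)) {{positive (ℕtoℚ-pos b)}} δ<1)))
    [1+b]w≤an : ∀ {w n} → ℕtoℚ w ≤ mkℚ (ℤ.+ a) b cop * ℕtoℚ n → suc b ℕ.* w ℕ.≤ a ℕ.* n
    [1+b]w≤an {w} {n} w≤δn = ℕtoℚ-cancel-≤ (subst₂ _≤_ (sym (ℕtoℚ-* (suc b) w))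
      (trans (sym (*-assoc (ℕtoℚ (suc b)) _ (ℕtoℚ n))) (trans (cong (_* ℕtoℚ n) ([1+b]*mkℚ[c,b]≡c a b cop)) (sym (ℕtoℚ-* a n))))
      (*-monoˡ-≤-0≤ (ℕtoℚ-nonNeg (suc b)) w≤δn))
  linear-gap {mkℚ ℤ.-[1+ a ] b cop} 0≤δ _ = contradiction (<-≤-trans (negative⁻¹ _) 0≤δ) (<-irrefl refl)

  0<mkℚ⇒1≤numerator : ∀ a b .(cop : Coprime.Coprime a (suc b)) → 0ℚ < mkℚ (ℤ.+ a) b cop → 1 ℕ.≤ a
  0<mkℚ⇒1≤numerator zero    b cop 0<δ = contradiction (subst (0ℚ <_) ([1+b]*mkℚ[c,b]≡c 0 b cop)
    (subst (_< ℕtoℚ (suc b) * mkℚ (ℤ.+ 0) b cop) (*-zeroʳ (ℕtoℚ (suc b)))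
      (*-monoʳ-<-pos (ℕtoℚ (suc b)) {{positive (ℕtoℚ-pos b)}} 0<δ))) (<-irrefl refl)
  0<mkℚ⇒1≤numerator (suc a) b cop 0<δ = ℕ.s≤s ℕ.z≤n

  1/[1+_] : ℕ → ℚ
  1/[1+ L ] = mkℚ (ℤ.+ 1) L (Coprime.1-coprimeTo (suc L))

  small-reciprocal : ∀ {ε} → 0ℚ < ε → ∃ λ L → 1/[1+ L ] + 1/[1+ L ] ≤ ε × 1/[1+ L ] + 1/[1+ L ] ≤ 1ℚ
  small-reciprocal {mkℚ (ℤ.+ a) b cop} 0<ε = L , y+y≤ε , y+y≤1
    where
    L : ℕ
    L = b ℕ.+ suc b
    y : ℚ
    y = 1/[1+ L ]
    [1+b]*[y+y]≡1 : ℕtoℚ (suc b) * (y + y) ≡ 1ℚ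
    [1+b]*[y+y]≡1 = trans (solve 2 (λ c y → c :* (y :+ y) := (c :+ c) :* y) refl (ℕtoℚ (suc b)) y)
      (trans (cong (_* y) (sym (ℕtoℚ-+ (suc b) (suc b)))) ([1+b]*mkℚ[c,b]≡c 1 L (Coprime.1-coprimeTo (suc L))))
    1≤a : 1 ℕ.≤ a
    1≤a = 0<mkℚ⇒1≤numerator a b cop 0<ε
    y+y≤ε : y + y ≤ mkℚ (ℤ.+ a) b cop
    y+y≤ε = *-cancelˡ-≤-ℕtoℚ b (≤-trans (≤-reflexive [1+b]*[y+y]≡1)
              (≤-trans (ℕtoℚ-mono 1≤a) (≤-reflexive (sym ([1+b]*mkℚ[c,b]≡c a b cop)))))
    y+y≤1 : y + y ≤ 1ℚ
    y+y≤1 = *-cancelˡ-≤-ℕtoℚ b (≤-trans (≤-reflexive [1+b]*[y+y]≡1)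
              (≤-trans (ℕtoℚ-mono {1} {suc b} (ℕ.s≤s ℕ.z≤n)) (≤-reflexive (sym (*-identityʳ (ℕtoℚ (suc b)))))))
  small-reciprocal {mkℚ ℤ.-[1+ a ] b cop} 0<ε = contradiction 0<ε (<-asym (negative⁻¹ _))

  ⌊n/2⌋+⌊n/2⌋≤n : ∀ n → ℕ.⌊ n /2⌋ ℕ.+ ℕ.⌊ n /2⌋ ℕ.≤ n
  ⌊n/2⌋+⌊n/2⌋≤n n = ℕ.≤-trans (ℕ.+-monoʳ-≤ ℕ.⌊ n /2⌋ (ℕ.⌊n/2⌋≤⌈n/2⌉ n)) (ℕ.≤-reflexive (ℕ.⌊n/2⌋+⌈n/2⌉≡n n))

  n≤4*⌊n/2⌋ : ∀ n → 2 ℕ.≤ n → n ℕ.≤ 4 ℕ.* ℕ.⌊ n /2⌋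
  n≤4*⌊n/2⌋ 1 (ℕ.s≤s ())
  n≤4*⌊n/2⌋ 2 _ = ℕ.s≤s (ℕ.s≤s ℕ.z≤n)
  n≤4*⌊n/2⌋ 3 _ = ℕ.s≤s (ℕ.s≤s (ℕ.s≤s ℕ.z≤n))
  n≤4*⌊n/2⌋ (suc (suc m@(suc (suc _)))) _ = begin
    suc (suc m)              ≤⟨ ℕ.s≤s (ℕ.s≤s (n≤4*⌊n/2⌋ m (ℕ.s≤s (ℕ.s≤s ℕ.z≤n)))) ⟩
    2 ℕ.+ 4 ℕ.* ℕ.⌊ m /2⌋    ≤⟨ ℕ.+-monoˡ-≤ (4 ℕ.* ℕ.⌊ m /2⌋) (ℕ.m≤m+n 2 2) ⟩
    4 ℕ.+ 4 ℕ.* ℕ.⌊ m /2⌋    ≡⟨ ℕ.*-suc 4 ℕ.⌊ m /2⌋ ⟨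
    4 ℕ.* suc ℕ.⌊ m /2⌋      ∎
    where open ℕ.≤-Reasoning

  private
    regroup : ∀ c e Q p → c * e * (Q * p) * (p * e) ≡ c * (Q * ((p * e) * (p * e)))
    regroup = solve 4 (λ c e Q p → c :* e :* (Q :* p) :* (p :* e) := c :* (Q :* ((p :* e) :* (p :* e)))) refl

    regroup₂ : ∀ a b c d → a * (b * (c * d)) ≡ (a * c) * (b * d)
    regroup₂ = solve 4 (λ a b c d → a :* (b :* (c :* d)) := (a :* c) :* (b :* d)) refl

  -- With j = k − 1: n^j ≤ K·D, hence n^j ≤ κ·⌊D/2⌋, and once p·n^j ≥ threshold the
  -- decay factor x is at most 64κ²/(p·n^j) ≤ y.
  module Regime (i r L : ℕ) where

    j : ℕ
    j = suc i

    K : ℕ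
    K = (2 ℕ.* j ℕ.* suc r) ℕ.^ j

    κ : ℕ
    κ = 4 ℕ.* K

    threshold : ℕ
    threshold = 64 ℕ.* (κ ℕ.* κ) ℕ.* suc L

    y : ℚ
    y = 1/[1+ L ]

    1≤K : 1 ℕ.≤ K
    1≤K = ℕ.m^n>0 (2 ℕ.* j ℕ.* suc r) j

    [1+L]*y≡1 : ℕtoℚ (suc L) * y ≡ 1ℚ
    [1+L]*y≡1 = [1+b]*mkℚ[c,b]≡c 1 L (Coprime.1-coprimeTo (suc L))

    1≤threshold : 1 ℕ.≤ threshold
    1≤threshold = ℕ.*-mono-≤ {1} {64 ℕ.* (κ ℕ.* κ)} {1} {suc L}
      (ℕ.*-mono-≤ {1} {64} {1} {κ ℕ.* κ} (ℕ.s≤s ℕ.z≤n) (ℕ.*-mono-≤ {1} {κ} {1} {κ} 1≤κ 1≤κ)) (ℕ.s≤s ℕ.z≤n)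
      where
      1≤κ : 1 ℕ.≤ κ
      1≤κ = ℕ.*-mono-≤ {1} {4} {1} {K} (ℕ.s≤s ℕ.z≤n) 1≤K

    module _ {n : ℕ} {p : ℚ} (0≤p : 0ℚ ≤ p) (p≤1 : p ≤ 1ℚ) (2jr≤n : 2 ℕ.* j ℕ.* suc r ℕ.≤ n) (2K≤n : 2 ℕ.* K ℕ.≤ n)
             (threshold≤pn^j : ℕtoℚ threshold ≤ p * ℕtoℚ (n ℕ.^ j)) where

      decay-factor≤y : ∀ w → n ℕ.≤ suc r ℕ.* (n ∸ w) →
                       ℕtoℚ (64 ℕ.* n ℕ.^ j) * ((1ℚ - p) ^ ((n ∸ w) C j) * p) ≤ y
      decay-factor≤y w n≤r[n∸w] = *-cancelʳ-≤-pos g {{positive 0<g}} (begin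
        ℕtoℚ (64 ℕ.* n ℕ.^ j) * ((1ℚ - p) ^ D * p) * g
          ≡⟨ cong (λ z → z * ((1ℚ - p) ^ D * p) * g) (ℕtoℚ-* 64 (n ℕ.^ j)) ⟩
        ℕtoℚ 64 * e * ((1ℚ - p) ^ D * p) * (p * e)
          ≡⟨ regroup (ℕtoℚ 64) e ((1ℚ - p) ^ D) p ⟩
        ℕtoℚ 64 * ((1ℚ - p) ^ D * ((p * e) * (p * e)))
          ≤⟨ *-monoˡ-≤-0≤ (ℕtoℚ-nonNeg 64) ([1-p]^D*[pe]²≤κ² ℕ.⌊ D /2⌋ D (n ℕ.^ j) κ 0≤p p≤1 (⌊n/2⌋+⌊n/2⌋≤n D) n^j≤κT) ⟩
        ℕtoℚ 64 * ℕtoℚ (κ ℕ.* κ)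
          ≡⟨ ℕtoℚ-* 64 (κ ℕ.* κ) ⟨
        ℕtoℚ (64 ℕ.* (κ ℕ.* κ))
          ≡⟨ trans (sym (*-identityʳ (ℕtoℚ (64 ℕ.* (κ ℕ.* κ))))) (cong (ℕtoℚ (64 ℕ.* (κ ℕ.* κ)) *_) (sym [1+L]*y≡1)) ⟩
        ℕtoℚ (64 ℕ.* (κ ℕ.* κ)) * (ℕtoℚ (suc L) * y)
          ≡⟨ trans (sym (*-assoc (ℕtoℚ (64 ℕ.* (κ ℕ.* κ))) (ℕtoℚ (suc L)) y)) (cong (_* y) (sym (ℕtoℚ-* (64 ℕ.* (κ ℕ.* κ)) (suc L)))) ⟩
        ℕtoℚ threshold * y
          ≤⟨ *-monoʳ-≤-0≤ (nonNegative⁻¹ y) threshold≤pn^j ⟩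
        g * y
          ≡⟨ *-comm g y ⟩
        y * g ∎)
        where
        open ≤-Reasoning
        m D : ℕ
        m = n ∸ w
        D = m C j
        e g : ℚ
        e = ℕtoℚ (n ℕ.^ j)
        g = p * e
        0<g : 0ℚ < g
        0<g = <-≤-trans (<-≤-trans (ℕtoℚ-pos 0) (ℕtoℚ-mono 1≤threshold)) threshold≤pn^j
        2j≤m : 2 ℕ.* j ℕ.≤ m
        2j≤m = ℕ.*-cancelˡ-≤ (suc r) (ℕ.≤-trans (ℕ.≤-reflexive (ℕ.*-comm (suc r) (2 ℕ.* j))) (ℕ.≤-trans 2jr≤n n≤r[n∸w]))
        n^j≤KD : n ℕ.^ j ℕ.≤ K ℕ.* D
        n^j≤KD = n^j≤[2jr]^j*mCj j (suc r) n m n≤r[n∸w] 2j≤m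
        n≤n^j : n ℕ.≤ n ℕ.^ j
        n≤n^j = ℕ.≤-trans (ℕ.≤-reflexive (sym (ℕ.*-identityʳ n)))
                  (ℕ.*-monoʳ-≤ n (ℕ.m^n>0 n {{ℕ.>-nonZero (ℕ.≤-trans (ℕ.≤-trans 1≤K (ℕ.m≤m+n K (K ℕ.+ 0))) 2K≤n)}} i))
        2≤D : 2 ℕ.≤ D
        2≤D = ℕ.*-cancelˡ-≤ K {{ℕ.>-nonZero 1≤K}}
                (ℕ.≤-trans (ℕ.≤-reflexive (ℕ.*-comm K 2)) (ℕ.≤-trans 2K≤n (ℕ.≤-trans n≤n^j n^j≤KD)))
        n^j≤κT : n ℕ.^ j ℕ.≤ κ ℕ.* ℕ.⌊ D /2⌋
        n^j≤κT = ℕ.≤-trans n^j≤KD (ℕ.≤-trans (ℕ.*-monoʳ-≤ K (n≤4*⌊n/2⌋ D 2≤D))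
                   (ℕ.≤-reflexive (trans (sym (ℕ.*-assoc K 4 _)) (cong (ℕ._* ℕ.⌊ D /2⌋) (ℕ.*-comm K 4)))))

      term≤y^w : ∀ w → n ℕ.≤ suc r ℕ.* (n ∸ w) → ℕtoℚ (n C w) * badSetBound n j p w ≤ y ^ w
      term≤y^w w n≤r[n∸w] = begin
        ℕtoℚ (n C w) * (q ^ (w ℕ.* D) * (ℕtoℚ (M C w) * p ^ w))
          ≡⟨ cong (λ z → ℕtoℚ (n C w) * (z * (ℕtoℚ (M C w) * p ^ w)))
                  (trans (cong (q ^_) (ℕ.*-comm w D)) (sym (^-assocʳ q D w))) ⟩
        ℕtoℚ (n C w) * ((q ^ D) ^ w * (ℕtoℚ (M C w) * p ^ w))
          ≡⟨ regroup₂ (ℕtoℚ (n C w)) ((q ^ D) ^ w) (ℕtoℚ (M C w)) (p ^ w) ⟩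
        ℕtoℚ (n C w) * ℕtoℚ (M C w) * ((q ^ D) ^ w * p ^ w)
          ≡⟨ cong (_* ((q ^ D) ^ w * p ^ w)) (ℕtoℚ-* (n C w) (M C w)) ⟨
        ℕtoℚ ((n C w) ℕ.* (M C w)) * ((q ^ D) ^ w * p ^ w)
          ≤⟨ *-monoʳ-≤-0≤ (0≤* (^-nonNeg w (^-nonNeg D 0≤q)) (^-nonNeg w 0≤p)) (ℕtoℚ-mono (nCk*[k²n^i]Ck≤[64*n^[1+i]]^k n i w)) ⟩
        ℕtoℚ ((64 ℕ.* n ℕ.^ j) ℕ.^ w) * ((q ^ D) ^ w * p ^ w)
          ≡⟨ cong₂ _*_ (ℕtoℚ-^ (64 ℕ.* n ℕ.^ j) w) (sym (^-distrib-* (q ^ D) p w)) ⟩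
        ℕtoℚ (64 ℕ.* n ℕ.^ j) ^ w * (q ^ D * p) ^ w
          ≡⟨ ^-distrib-* (ℕtoℚ (64 ℕ.* n ℕ.^ j)) (q ^ D * p) w ⟨
        (ℕtoℚ (64 ℕ.* n ℕ.^ j) * (q ^ D * p)) ^ w
          ≤⟨ ^-monoˡ-≤ w (0≤* (ℕtoℚ-nonNeg (64 ℕ.* n ℕ.^ j)) (0≤* (^-nonNeg D 0≤q) 0≤p)) (decay-factor≤y w n≤r[n∸w]) ⟩
        y ^ w ∎
        where
        open ≤-Reasoning
        q : ℚ
        q = 1ℚ - p
        0≤q : 0ℚ ≤ q
        0≤q = 0≤1-p p≤1
        D : ℕ
        D = (n ∸ w) C j
        M : ℕ
        M = w ℕ.^ 2 ℕ.* n ℕ.^ i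

module Union where
  open import Data.Nat as ℕ using (ℕ; zero; suc; _∸_)
  import Data.Nat.Properties as ℕ
  open import Data.Nat.Combinatorics using (_C_)
  open import Data.Rational hiding (∣_∣; _≤ᵇ_)
  open import Data.Rational.Properties
  open import Data.Rational.Solver using (module +-*-Solver)
  open import Data.List using (List; map)
  open import Data.Product using (_×_; _,_)
  open import Data.Fin.Subset using (∣_∣)
  open import Relation.Nullary using (¬_; Dec; yes; no; _×-dec_)
  open import Relation.Binary.PropositionalEquality
  open import Defs
  open Power
  open Distribution using (mass; mass-∅; mass-any≤sum; mass-¬+mass≡total; outcomes-nonNeg; outcomes-total)
  open BadSets using (badSet?; badSet⇒size; badSetBound; mass-badSet≤)
  open Sums using (sumTo; sumTo-mono; sumℚ-mono; sum-subsets-by-size; geometric-≤)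
  open Asymptotics using (module Regime)
  open +-*-Solver

  private
    a+b-b≡a : ∀ a b → a + b - b ≡ a
    a+b-b≡a = solve 2 (λ a b → a :+ b :- b := a) refl

  module _ (δ : ℚ) (i r L : ℕ) (gap : ∀ {w n} → ℕtoℚ w ≤ δ * ℕtoℚ n → n ℕ.≤ suc r ℕ.* (n ∸ w)) where
    open Regime i r L

    module _ {n : ℕ} {p : ℚ} (0≤p : 0ℚ ≤ p) (p≤1 : p ≤ 1ℚ) (2jr≤n : 2 ℕ.* j ℕ.* suc r ℕ.≤ n) (2K≤n : 2 ℕ.* K ℕ.≤ n)
             (threshold≤pn^j : ℕtoℚ threshold ≤ p * ℕtoℚ (n ℕ.^ j)) where

      Admissible : ℕ → Set
      Admissible w = 1 ℕ.≤ w × ℕtoℚ w ≤ δ * ℕtoℚ n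

      admissible? : ∀ w → Dec (Admissible w)
      admissible? w = (1 ℕ.≤? w) ×-dec (ℕtoℚ w ≤? δ * ℕtoℚ n)

      boundIf : ∀ w → Dec (Admissible w) → ℚ
      boundIf w (yes _) = badSetBound n j p w
      boundIf w (no  _) = 0ℚ

      sizeBound : ℕ → ℚ
      sizeBound w = boundIf w (admissible? w)

      mass-badSet≤sizeBound : ∀ W → mass (badSet? δ W) (outcomes p (kSubsets n (suc j))) ≤ sizeBound ∣ W ∣
      mass-badSet≤sizeBound W = by-admissibility (admissible? ∣ W ∣)
        where
        by-admissibility : (d : Dec (Admissible ∣ W ∣)) → mass (badSet? δ W) (outcomes p (kSubsets n (suc j))) ≤ boundIf ∣ W ∣ d
        by-admissibility (yes _) = mass-badSet≤ δ j 0≤p p≤1 (ℕ.s≤s ℕ.z≤n) W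
        by-admissibility (no ¬a) = ≤-reflexive (mass-∅ (badSet? δ W) (outcomes p (kSubsets n (suc j))) (λ _ bad → ¬a (badSet⇒size δ W bad)))

      y^⁺ : ℕ → ℚ
      y^⁺ zero    = 0ℚ
      y^⁺ (suc w) = y ^ suc w

      weighted-sizeBound≤y^⁺ : ∀ w → ℕtoℚ (n C w) * sizeBound w ≤ y^⁺ w
      weighted-sizeBound≤y^⁺ w = by-admissibility w (admissible? w)
        where
        by-admissibility : ∀ w (d : Dec (Admissible w)) → ℕtoℚ (n C w) * boundIf w d ≤ y^⁺ w
        by-admissibility zero    (yes (() , _))
        by-admissibility (suc w) (yes (_ , w≤δn)) = term≤y^w 0≤p p≤1 2jr≤n 2K≤n threshold≤pn^j (suc w) (gap {suc w} {n} w≤δn)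
        by-admissibility zero    (no _) = ≤-reflexive (*-zeroʳ (ℕtoℚ (n C zero)))
        by-admissibility (suc w) (no _) = ≤-trans (≤-reflexive (*-zeroʳ (ℕtoℚ (n C suc w)))) (^-nonNeg (suc w) (nonNegative⁻¹ y))

      mass-containsBadSet≤y+y : y + y ≤ 1ℚ → mass (containsBadSet? δ) (outcomes p (kSubsets n (suc j))) ≤ y + y
      mass-containsBadSet≤y+y y+y≤1 = begin
        mass (containsBadSet? δ) O
          ≤⟨ mass-any≤sum (λ W → badSet? δ W) (subsets n) O (outcomes-nonNeg (kSubsets n (suc j)) 0≤p p≤1) ⟩
        sumℚ (map (λ W → mass (badSet? δ W) O) (subsets n))
          ≤⟨ sumℚ-mono (subsets n) mass-badSet≤sizeBound ⟩
        sumℚ (map (λ W → sizeBound ∣ W ∣) (subsets n))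
          ≡⟨ sum-subsets-by-size n sizeBound ⟩
        sumTo (suc n) (λ w → ℕtoℚ (n C w) * sizeBound w)
          ≤⟨ sumTo-mono (suc n) weighted-sizeBound≤y^⁺ ⟩
        sumTo (suc n) y^⁺
          ≡⟨⟩
        0ℚ + sumTo n (λ w → y ^ suc w)
          ≡⟨ +-identityˡ (sumTo n (λ w → y ^ suc w)) ⟩
        sumTo n (λ w → y ^ suc w)
          ≤⟨ geometric-≤ n (nonNegative⁻¹ y) y+y≤1 ⟩
        y + y ∎
        where
        open ≤-Reasoning
        O : List (Hypergraph n × ℚ)
        O = outcomes p (kSubsets n (suc j))

      1-[y+y]≤Pr[noBadSet] : y + y ≤ 1ℚ → 1ℚ - (y + y) ≤ Pr[H_k] (suc j) n p (λ H → ¬ ContainsBadSet δ H) (noBadSet? δ)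
      1-[y+y]≤Pr[noBadSet] y+y≤1 = begin
        1ℚ - (y + y)                   ≤⟨ +-monoʳ-≤ 1ℚ (neg-antimono-≤ (mass-containsBadSet≤y+y y+y≤1)) ⟩
        1ℚ - mass (containsBadSet? δ) O ≡⟨ cong (_- mass (containsBadSet? δ) O) (trans (sym (outcomes-total p (kSubsets n (suc j))))
                                            (sym (mass-¬+mass≡total (containsBadSet? δ) O))) ⟩
        mass (noBadSet? δ) O + mass (containsBadSet? δ) O - mass (containsBadSet? δ) O
                                        ≡⟨ a+b-b≡a (mass (noBadSet? δ) O) (mass (containsBadSet? δ) O) ⟩
        mass (noBadSet? δ) O            ∎
        where
        open ≤-Reasoning
        O : List (Hypergraph n × ℚ)
        O = outcomes p (kSubsets n (suc j))

open import Defs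
open import Data.Nat using (ℕ; _∸_; _^_) renaming (_≤_ to _≤ℕ_)
open import Data.Rational using (ℚ; 0ℚ; 1ℚ; _<_; _≤_; _*_; _-_)
open import Data.Product using (_×_; ∃)
open import Relation.Nullary using (¬_)

import Data.Nat as ℕ
import Data.Nat.Properties as ℕ
open import Data.Rational using (_+_)
open import Data.Rational.Properties using (<⇒≤; ≤-trans; +-monoʳ-≤; neg-antimono-≤)
open import Data.Product using (_,_; proj₁; proj₂; map₂)
open Asymptotics using (linear-gap; small-reciprocal; 1/[1+_]; module Regime)
open Union using (1-[y+y]≤Pr[noBadSet])

noBadSet-whp : ∀ i r L (δ : ℚ) → (∀ {w n} → ℕtoℚ w ≤ δ * ℕtoℚ n → n ≤ℕ ℕ.suc r ℕ.* (n ∸ w)) →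
  let y = 1/[1+ L ] in y + y ≤ 1ℚ →
  (p : ℕ → ℚ) → (∀ n → 0ℚ ≤ p n × p n ≤ 1ℚ) →
  (∀ (M : ℚ) → ∃ λ N → ∀ n → N ≤ℕ n → M ≤ p n * ℕtoℚ (n ^ ℕ.suc i)) →
  ∃ λ N → ∀ n → N ≤ℕ n → 1ℚ - (y + y) ≤ Pr[H_k] (ℕ.suc (ℕ.suc i)) n (p n) (λ H → ¬ ContainsBadSet δ H) (noBadSet? δ)
noBadSet-whp i r L δ gap y+y≤1 p 0≤p≤1 dense = N₀ ℕ.+ (2jr ℕ.+ 2 ℕ.* K) , whp
  where
  open Regime i r L
  2jr : ℕ
  2jr = 2 ℕ.* j ℕ.* ℕ.suc r
  N₀ : ℕ
  N₀ = proj₁ (dense (ℕtoℚ threshold))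
  whp : ∀ n → N₀ ℕ.+ (2jr ℕ.+ 2 ℕ.* K) ≤ℕ n →
        1ℚ - (y + y) ≤ Pr[H_k] (ℕ.suc j) n (p n) (λ H → ¬ ContainsBadSet δ H) (noBadSet? δ)
  whp n N≤n = 1-[y+y]≤Pr[noBadSet] δ i r L (λ {w} {n} → gap {w} {n}) (proj₁ (0≤p≤1 n)) (proj₂ (0≤p≤1 n))
    (ℕ.≤-trans (ℕ.m≤m+n 2jr (2 ℕ.* K)) (ℕ.≤-trans (ℕ.m≤n+m (2jr ℕ.+ 2 ℕ.* K) N₀) N≤n))
    (ℕ.≤-trans (ℕ.m≤n+m (2 ℕ.* K) 2jr) (ℕ.≤-trans (ℕ.m≤n+m (2jr ℕ.+ 2 ℕ.* K) N₀) N≤n))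
    (proj₂ (dense (ℕtoℚ threshold)) n (ℕ.≤-trans (ℕ.m≤m+n N₀ (2jr ℕ.+ 2 ℕ.* K)) N≤n))
    y+y≤1

lemma3p3 : (k : ℕ) → 3 ≤ℕ k →
    (δ : ℚ) → 0ℚ < δ → δ < 1ℚ →
    (p : ℕ → ℚ) → (∀ n → 0ℚ ≤ p n × p n ≤ 1ℚ) →
    (∀ (M : ℚ) → ∃ λ N → ∀ n → N ≤ℕ n → M ≤ p n * ℕtoℚ (n ^ (k ∸ 1))) →
    ∀ (ε : ℚ) → 0ℚ < ε → ∃ λ N → ∀ n → N ≤ℕ n →
      1ℚ - ε ≤ Pr[H_k] k n (p n) (λ H → ¬ ContainsBadSet δ H) (noBadSet? δ)
lemma3p3 (ℕ.suc (ℕ.suc i)) _ δ 0<δ δ<1 p 0≤p≤1 dense ε 0<ε =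
  let r , gap              = linear-gap (<⇒≤ 0<δ) δ<1
      L , y+y≤ε , y+y≤1    = small-reciprocal 0<ε
  in map₂ (λ whp n N≤n → ≤-trans (+-monoʳ-≤ 1ℚ (neg-antimono-≤ y+y≤ε)) (whp n N≤n))
          (noBadSet-whp i r L δ (λ {w} {n} → gap {w} {n}) y+y≤1 p 0≤p≤1 dense)
lemma3p3 1 (ℕ.s≤s ())
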